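{- For all $t,t'\in\mathbb{T}^\infty$: if $t\to^{2\infty}t'$ then $t\to^\infty t'$.
   Context: Fix a countably infinite set of variables and a countable set of constructors. $\mathbb{T}^\infty$ is the set of finite and infinite terms (modulo $\alpha$-conversion) generated by $t ::= x \mid c \mid \lambda x.t \mid t\,t \mid \mathrm{case}(t;\{c_k\vec{x}_k \Rightarrow t_k \mid k=1,\dots,n\})$ ($x$ variables, $c,c_k$ constructors). One-step reduction $\to_{\beta\iota}$ is the closure under term contexts of $(\lambda x.t)t' \to t[t'/x]$ and $\mathrm{case}(c_k\vec u;\{c_l\vec x_l\Rightarrow t_l\}) \to t_k[\vec u/\vec x_k]$ ($\vec u,\vec x_k$ of the same length, variables in each $\vec x_l$ pairwise distinct, $c_l$ pairwise distinct); $\to^*$ is its reflexive–transitive closure. Infinitary reduction $\to^\infty$ is the largest relation such that whenever $t\to^\infty t'$ one of the following holds: $t'$ is a variable or constructor and $t\to^*t'$; $t'=\lambda x.r'$, $t\to^*\lambda x.r$ and $r\to^\infty r'$; $t'=r_1'r_2'$, $t\to^*r_1r_2$, $r_1\to^\infty r_1'$ and $r_2\to^\infty r_2'$; $t'=\mathrm{case}(r';\{c_k\vec x_k\Rightarrow r_k'\})$, $t\to^*\mathrm{case}(r;\{c_k\vec x_k\Rightarrow r_k\})$, $r\to^\infty r'$ and $r_k\to^\infty r_k'$ for all $k$. The relation $\to^{2\infty}$ is the largest relation defined by the same clauses but with $\to^*$ replaced by $\to^\infty$ and $\to^\infty$ replaced by $\to^{2\infty}$: whenever $t\to^{2\infty}t'$,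 either $t'$ is a variable or constructor and $t\to^\infty t'$; or $t'=\lambda x.r'$, $t\to^\infty\lambda x.r$ and $r\to^{2\infty}r'$; or $t'=r_1'r_2'$, $t\to^\infty r_1r_2$ and $r_i\to^{2\infty}r_i'$; or $t'=\mathrm{case}(r';\{c_k\vec x_k\Rightarrow r_k'\})$, $t\to^\infty\mathrm{case}(r;\{c_k\vec x_k\Rightarrow r_k\})$, $r\to^{2\infty}r'$ and $r_k\to^{2\infty}r_k'$. -}

module Defs where

open import Level using (Level; _⊔_)
open import Data.Bool using (true; false)
open import Data.Nat using (ℕ; zero; suc; _+_; _∸_; _<_; _<ᵇ_)
open import Data.List using (List; []; _∷_; map; length; _∷ʳ_; _++_)
open import Data.Maybe using (Maybe; just; nothing; Is-just)
import Data.Maybe as Maybe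
open import Data.List.Membership.Propositional using (_∈_)
open import Data.List.Relation.Unary.Unique.Propositional using (Unique)
open import Data.List.Relation.Binary.Pointwise using (Pointwise)
open import Data.Product using (Σ; _×_; _,_; proj₁)
open import Data.Sum using (_⊎_)
open import Data.Unit using (⊤)
open import Relation.Binary.PropositionalEquality using (_≡_)

-- Since coinduction (--guardedness) is unavailable, a (possibly infinite)
-- term is represented as a labelled tree: a partial function from positions
-- (finite paths, lists of child indices) to node labels, defined exactly on
-- a prefix-closed set of positions compatible with the arities.
-- α-conversion is handled by de Bruijn indices: variables are ℕ; binders
-- are the λ node (child 0 is under 1 binder) and the case branches.

data Label : Set where
  var : ℕ → Label
  con : ℕ → Label
  lam : Label
  app : Label
  cas : List (ℕ × ℕ) → Label      -- case(_; {c_k x⃗_k ⇒ _}) : list of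
                                  -- (c_k , length of x⃗_k); children:
                                  -- 0 = scrutinee, 1+k = body of branch k

arity : Label → ℕ
arity (var _) = 0
arity (con _) = 0
arity lam = 1
arity app = 2
arity (cas sig) = suc (length sig)

nthArity : List (ℕ × ℕ) → ℕ → ℕ
nthArity [] _ = 0
nthArity ((_ , n) ∷ _) zero = n
nthArity (_ ∷ sig) (suc k) = nthArity sig k

binders : Label → ℕ → ℕ
binders lam zero = 1
binders (cas sig) (suc k) = nthArity sig k
binders _ _ = 0

Path : Set
Path = List ℕ

NodeFn : Set
NodeFn = Path → Maybe Label

record Term : Set where
  field
    node : NodeFn
    root : Is-just (node [])
    down : ∀ p ℓ k → node p ≡ just ℓ → k < arity ℓ → Is-just (node (p ++ k ∷ []))
    up   : ∀ p k → Is-just (node (p ++ k ∷ [])) →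
           Σ Label λ ℓ → node p ≡ just ℓ × k < arity ℓ

open Term public

_≈_ : Term → Term → Set
t ≈ u = ∀ p → node t p ≡ node u p

_≈ₙ_ : Term → NodeFn → Set
t ≈ₙ f = ∀ p → node t p ≡ f p

varNode : ℕ → NodeFn
varNode i [] = just (var i)
varNode i (_ ∷ _) = nothing

shiftLabel : ℕ → ℕ → Label → Label
shiftLabel n d (var j) with j <ᵇ d
... | true  = var j
... | false = var (n + j)
shiftLabel n d ℓ = ℓ

shiftNode : ℕ → ℕ → NodeFn → NodeFn
shiftNode n d g [] = Maybe.map (shiftLabel n d) (g [])
shiftNode n d g (k ∷ p) with g []
... | just ℓ  = shiftNode n (binders ℓ k + d) (λ q → g (k ∷ q)) p
... | nothing = nothing

-- substNode d σ f : f with every free variable i (index i + d below the d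
-- binders passed so far) replaced by σ i (suitably shifted).
substAt : ℕ → (ℕ → NodeFn) → NodeFn → Maybe Label → NodeFn
substNode : ℕ → (ℕ → NodeFn) → NodeFn → NodeFn

substAt d σ f (just (var i)) p with i <ᵇ d
... | true  = varNode i p
... | false = shiftNode d 0 (σ (i ∸ d)) p
substAt d σ f (just ℓ) [] = just ℓ
substAt d σ f (just ℓ) (k ∷ p) = substNode (binders ℓ k + d) σ (λ q → f (k ∷ q)) p
substAt d σ f nothing p = nothing

substNode d σ f p = substAt d σ f (f []) p

sub0 : Term → ℕ → NodeFn
sub0 a zero = node a
sub0 a (suc i) = varNode i

-- [u⃗/x⃗] for the n = length u⃗ bound variables of a branch body:
-- index i < n refers to x_{i+1}; free indices ≥ n are shifted down by n.
listSub : List Term → ℕ → NodeFn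
listSub [] i = varNode i
listSub (u ∷ us) zero = node u
listSub (u ∷ us) (suc i) = listSub us i

Sub : Term → ℕ → Term → Set
Sub t k r = ∀ p → node r p ≡ node t (k ∷ p)

-- a case branch c x⃗ ⇒ body, recorded as (c , length x⃗ , body)
Branch : Set
Branch = ℕ × ℕ × Term

sigOf : List Branch → List (ℕ × ℕ)
sigOf = map (λ { (c , n , _) → (c , n) })

SubsFrom : Term → ℕ → List Branch → Set
SubsFrom t k [] = ⊤
SubsFrom t k ((_ , _ , b) ∷ bs) = Sub t k b × SubsFrom t (suc k) bs

IsLam : Term → Term → Set
IsLam t r = (node t [] ≡ just lam) × Sub t 0 r

IsApp : Term → Term → Term → Set
IsApp t r s = (node t [] ≡ just app) × Sub t 0 r × Sub t 1 s

IsCas : Term → Term → List Branch → Set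
IsCas t r bs = (node t [] ≡ just (cas (sigOf bs))) × Sub t 0 r × SubsFrom t 1 bs

data Spine : Term → ℕ → List Term → Set where
  sc : ∀ {t c} → node t [] ≡ just (con c) → Spine t c []
  sa : ∀ {t f u c us} → IsApp t f u → Spine f c us → Spine t c (us ∷ʳ u)

data OneBranch (R : Term → Term → Set) : List Branch → List Branch → Set where
  here  : ∀ {c n b b' bs} → R b b' → OneBranch R ((c , n , b) ∷ bs) ((c , n , b') ∷ bs)
  there : ∀ {x bs bs'} → OneBranch R bs bs' → OneBranch R (x ∷ bs) (x ∷ bs')

data _⟶_ (t t' : Term) : Set where
  β    : ∀ {f a b} → IsApp t f a → IsLam f b →
         t' ≈ₙ substNode 0 (sub0 a) (node b) → t ⟶ t'
  ι    : ∀ {s bs c us b} → IsCas t s bs → Unique (map proj₁ bs) →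
         Spine s c us → (c , length us , b) ∈ bs →
         t' ≈ₙ substNode 0 (listSub us) (node b) → t ⟶ t'
  lamC : ∀ {r r'} → IsLam t r → IsLam t' r' → r ⟶ r' → t ⟶ t'
  appL : ∀ {r r' s} → IsApp t r s → IsApp t' r' s → r ⟶ r' → t ⟶ t'
  appR : ∀ {r s s'} → IsApp t r s → IsApp t' r s' → s ⟶ s' → t ⟶ t'
  casS : ∀ {r r' bs} → IsCas t r bs → IsCas t' r' bs → r ⟶ r' → t ⟶ t'
  casB : ∀ {r bs bs'} → IsCas t r bs → IsCas t' r bs' → OneBranch _⟶_ bs bs' → t ⟶ t'

data _⟶*_ : Term → Term → Set where
  refl* : ∀ {t t'} → t ≈ t' → t ⟶* t'
  step* : ∀ {t u v} → t ⟶ u → u ⟶* v → t ⟶* v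

-- The common clauses of →∞ and →2∞: S is the "prefix" relation
-- (→* resp. →∞), R the coinductively defined one (→∞ resp. →2∞).

BrRel : ∀ {ℓ} → (Term → Term → Set ℓ) → Branch → Branch → Set ℓ
BrRel R (c , n , b) (c' , n' , b') = (c ≡ c') × (n ≡ n') × R b b'

Clauses : ∀ {a b} → (Term → Term → Set a) → (Term → Term → Set b) →
          Term → Term → Set (a ⊔ b)
Clauses S R t t' =
    (Σ ℕ λ x → (node t' [] ≡ just (var x)) × S t t')
  ⊎ (Σ ℕ λ c → (node t' [] ≡ just (con c)) × S t t')
  ⊎ (Σ Term λ r' → Σ Term λ u → Σ Term λ r →
       IsLam t' r' × S t u × IsLam u r × R r r')
  ⊎ (Σ Term λ r₁' → Σ Term λ r₂' → Σ Term λ u → Σ Term λ r₁ → Σ Term λ r₂ →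
       IsApp t' r₁' r₂' × S t u × IsApp u r₁ r₂ × R r₁ r₁' × R r₂ r₂')
  ⊎ (Σ Term λ r' → Σ (List Branch) λ bs' → Σ Term λ u → Σ Term λ r →
       Σ (List Branch) λ bs →
       IsCas t' r' bs' × S t u × IsCas u r bs × R r r' × Pointwise (BrRel R) bs bs')

-- Greatest relations satisfying the clauses: union of all post-fixpoints.
_⟶∞_ : Term → Term → Set₁
t ⟶∞ t' = Σ (Term → Term → Set) λ R →
            R t t' × (∀ a b → R a b → Clauses _⟶*_ R a b)

_⟶2∞_ : Term → Term → Set₁
t ⟶2∞ t' = Σ (Term → Term → Set) λ R →
             R t t' × (∀ a b → R a b → Clauses _⟶∞_ R a b)

-- Since _⟶∞_ is the greatest fixed point of its clauses, it suffices that "t ⟶∞ u ⟶2∞ t' for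
-- some u" is a post-fixed point; t ⟶2∞ t' is then the case u = t. Unfolding u ⟶2∞ t' once gives
-- a prefix u ⟶∞ w of the required shape; t ⟶∞ u ⟶∞ w collapses to t ⟶∞ w by transitivity of
-- _⟶∞_, and inverting that yields the finite prefix t ⟶* w' demanded by _⟶∞_. Transitivity is
-- proved the same way from the fact that a finite reduction can be appended to an infinitary
-- one; that in turn traces each redex back along t ⟶∞ u and uses that _⟶∞_ is closed under
-- substitution.
module Submission where

open import Defs
open import Level using (Level)
open import Data.Bool using (true; false)
open import Data.Bool.Properties using (T-≡)
open import Data.Empty using (⊥; ⊥-elim)
open import Data.List using (List; []; _∷_; _++_; _∷ʳ_; map; length; drop)
open import Data.List.Properties using (++-assoc; ++-identityʳ; ∷-injective; length-map; map-++; map-∘)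
open import Data.List.Membership.Propositional using (_∈_)
open import Data.List.Membership.Propositional.Properties using (∈-map⁺)
open import Data.List.Relation.Binary.Pointwise as Pointwise
  using (Pointwise; []; _∷_; ++⁺; Pointwise-length)
open import Data.List.Relation.Unary.Any using (here; there)
open import Data.List.Relation.Unary.Unique.Propositional using (Unique)
open import Data.Maybe using (Maybe; just; nothing; Is-just; _>>=_)
import Data.Maybe as Maybe
open import Data.Maybe.Relation.Unary.Any using (just)
open import Data.Maybe.Properties using (just-injective)
open import Data.Nat using (ℕ; zero; suc; _+_; _∸_; _<_; _≤_; _<ᵇ_; z≤n; s≤s; z<s; s<s; _≟_)
open import Data.Nat.Properties
open import Data.Nat.Tactic.RingSolver using (solve-∀)
open import Algebra.Properties.CommutativeSemigroup +-commutativeSemigroup using (x∙yz≈y∙xz)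
open import Data.Product using (Σ; _×_; _,_; proj₁; proj₂; uncurry)
open import Data.Sum using (_⊎_; inj₁; inj₂)
open import Data.Unit using (tt)
open import Function using (Equivalence)
open import Relation.Nullary using (¬_; yes; no)
open import Relation.Binary.PropositionalEquality
open ≡-Reasoning

private variable
  ℓa ℓb ℓc : Level
  t t' u v : Term

PostFixedPoint : (Term → Term → Set ℓa) → (Term → Term → Set ℓb) → Set (ℓa Level.⊔ ℓb)
PostFixedPoint S R = ∀ t t' → R t t' → Clauses S R t t'

pattern var-clause x e s = inj₁ (x , e , s)
pattern con-clause k e s = inj₂ (inj₁ (k , e , s))
pattern lam-clause r' w r l' s l ρ = inj₂ (inj₂ (inj₁ (r' , w , r , l' , s , l , ρ)))
pattern app-clause r₁' r₂' w r₁ r₂ a' s a ρ₁ ρ₂ =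
  inj₂ (inj₂ (inj₂ (inj₁ (r₁' , r₂' , w , r₁ , r₂ , a' , s , a , ρ₁ , ρ₂))))
pattern case-clause r' bs' w r bs c' s c ρ ρs =
  inj₂ (inj₂ (inj₂ (inj₂ (r' , bs' , w , r , bs , c' , s , c , ρ , ρs))))

map-BrRel : {R : Term → Term → Set ℓa} {R' : Term → Term → Set ℓb} →
            (∀ {x y} → R x y → R' x y) →
            ∀ {bs bs'} → Pointwise (BrRel R) bs bs' → Pointwise (BrRel R') bs bs'
map-BrRel f = Pointwise.map λ (c≡ , n≡ , ρ) → c≡ , n≡ , f ρ

map-Clauses : {S : Term → Term → Set ℓa} {R : Term → Term → Set ℓb} {R' : Term → Term → Set ℓc} →
              (∀ {x y} → R x y → R' x y) → Clauses S R t t' → Clauses S R' t t'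
map-Clauses f (var-clause x e s) = var-clause x e s
map-Clauses f (con-clause k e s) = con-clause k e s
map-Clauses f (lam-clause r' w r l' s l ρ) = lam-clause r' w r l' s l (f ρ)
map-Clauses f (app-clause r₁' r₂' w r₁ r₂ a' s a ρ₁ ρ₂) = app-clause r₁' r₂' w r₁ r₂ a' s a (f ρ₁) (f ρ₂)
map-Clauses f (case-clause r' bs' w r bs c' s c ρ ρs) = case-clause r' bs' w r bs c' s c (f ρ) (map-BrRel f ρs)

-- _⟶∞_ only quantifies over small relations, while the post-fixed points used below are large
-- (built from _⟶∞_ itself). A large W is replaced by the small relation "(a , b) labels some node
-- of the unfolding tree of a fixed W-proof", which is again a post-fixed point.
module _ {ℓ} (W : Term → Term → Set ℓ) (W-post : PostFixedPoint _⟶*_ W) where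

  private
    Node : Set ℓ
    Node = Σ (Term × Term) (uncurry W)

    branchChild : ∀ {bs bs'} → Pointwise (BrRel W) bs bs' → ℕ → Maybe Node
    branchChild [] k = nothing
    branchChild {(_ , _ , b) ∷ _} {(_ , _ , b') ∷ _} ((_ , _ , ρ) ∷ _) zero = just ((b , b') , ρ)
    branchChild (_ ∷ ρs) (suc k) = branchChild ρs k

    clauseChild : Clauses _⟶*_ W t t' → ℕ → Maybe Node
    clauseChild (lam-clause r' _ r _ _ _ ρ) zero = just ((r , r') , ρ)
    clauseChild (app-clause r₁' _ _ r₁ _ _ _ _ ρ₁ _) zero = just ((r₁ , r₁') , ρ₁)
    clauseChild (app-clause _ r₂' _ _ r₂ _ _ _ _ ρ₂) 1 = just ((r₂ , r₂') , ρ₂)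
    clauseChild (case-clause r' _ _ r _ _ _ _ ρ _) zero = just ((r , r') , ρ)
    clauseChild (case-clause _ _ _ _ _ _ _ _ _ ρs) (suc k) = branchChild ρs k
    clauseChild _ _ = nothing

    child : Node → ℕ → Maybe Node
    child ((t , t') , w) = clauseChild (W-post t t' w)

    unfold : Node → Path → Maybe Node
    unfold x [] = just x
    unfold x (k ∷ p) = child x k >>= λ y → unfold y p

    unfold-∷ʳ : ∀ x p k → unfold x (p ∷ʳ k) ≡ (unfold x p >>= λ y → child y k)
    unfold-∷ʳ x [] k with child x k
    ... | just _ = refl
    ... | nothing = refl
    unfold-∷ʳ x (k' ∷ p) k with child x k'
    ... | just y = unfold-∷ʳ y p k
    ... | nothing = refl

    module _ (x₀ : Node) where
      Reachable : Term → Term → Set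
      Reachable a b = Σ Path λ p → Maybe.map proj₁ (unfold x₀ p) ≡ just (a , b)

      ReachableNode : Maybe Node → Set ℓ
      ReachableNode m = Σ Path λ p → unfold x₀ p ≡ m

      reachable : ∀ {a b w} → ReachableNode (just ((a , b) , w)) → Reachable a b
      reachable (p , eq) = p , cong (Maybe.map proj₁) eq

      reachable-branches : ∀ {bs bs'} (ρs : Pointwise (BrRel W) bs bs') →
                           (∀ k → ReachableNode (branchChild ρs k)) → Pointwise (BrRel Reachable) bs bs'
      reachable-branches [] _ = []
      reachable-branches {(_ , _ , _) ∷ _} {(_ , _ , _) ∷ _} ((c≡ , n≡ , _) ∷ ρs) h =
        (c≡ , n≡ , reachable (h zero)) ∷ reachable-branches ρs λ k → h (suc k)

      reachable-clauses : (cl : Clauses _⟶*_ W t t') → (∀ k → ReachableNode (clauseChild cl k)) →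
                          Clauses _⟶*_ Reachable t t'
      reachable-clauses (var-clause x e s) h = var-clause x e s
      reachable-clauses (con-clause k e s) h = con-clause k e s
      reachable-clauses (lam-clause r' w r l' s l _) h = lam-clause r' w r l' s l (reachable (h 0))
      reachable-clauses (app-clause r₁' r₂' w r₁ r₂ a' s a _ _) h =
        app-clause r₁' r₂' w r₁ r₂ a' s a (reachable (h 0)) (reachable (h 1))
      reachable-clauses (case-clause r' bs' w r bs c' s c _ ρs) h =
        case-clause r' bs' w r bs c' s c (reachable (h 0)) (reachable-branches ρs λ k → h (suc k))

      witness : ∀ (m : Maybe Node) {a b} → Maybe.map proj₁ m ≡ just (a , b) →
                Σ (W a b) λ w → m ≡ just ((a , b) , w)
      witness (just (_ , w)) refl = w , refl

      Reachable-post : PostFixedPoint _⟶*_ Reachable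
      Reachable-post a b (p , eq) with witness (unfold x₀ p) eq
      ... | w , eq' = reachable-clauses (W-post a b w) λ k →
        p ∷ʳ k , trans (unfold-∷ʳ x₀ p k) (cong (λ m → m >>= λ y → child y k) eq')

  ⟶∞-coinduction : W t t' → t ⟶∞ t'
  ⟶∞-coinduction {t} {t'} w = Reachable x₀ , ([] , refl) , Reachable-post x₀
    where
    x₀ : Node
    x₀ = (t , t') , w

Sub-respˡ-≈ : ∀ {t t' k r} → t ≈ t' → Sub t k r → Sub t' k r
Sub-respˡ-≈ {k = k} e s p = trans (s p) (e (k ∷ p))

Sub-respʳ-≈ : ∀ {t k r r'} → r ≈ r' → Sub t k r → Sub t k r'
Sub-respʳ-≈ e s p = trans (sym (e p)) (s p)

Sub-unique : ∀ {t k r r'} → Sub t k r → Sub t k r' → r ≈ r'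
Sub-unique s s' p = trans (s p) (sym (s' p))

SubsFrom-respˡ-≈ : ∀ {t t' k} bs → t ≈ t' → SubsFrom t k bs → SubsFrom t' k bs
SubsFrom-respˡ-≈ [] e _ = tt
SubsFrom-respˡ-≈ {t} {t'} {k} ((_ , _ , b) ∷ bs) e (s , ss) =
  Sub-respˡ-≈ {t} {t'} {k} {b} e s , SubsFrom-respˡ-≈ {t} {t'} bs e ss

IsLam-respˡ-≈ : ∀ {t t' r} → t ≈ t' → IsLam t r → IsLam t' r
IsLam-respˡ-≈ {t} {t'} {r} e (h , s) = trans (sym (e [])) h , Sub-respˡ-≈ {t} {t'} {0} {r} e s

IsApp-respˡ-≈ : ∀ {t t' r s} → t ≈ t' → IsApp t r s → IsApp t' r s
IsApp-respˡ-≈ {t} {t'} {r} {s} e (h , s₁ , s₂) =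
  trans (sym (e [])) h , Sub-respˡ-≈ {t} {t'} {0} {r} e s₁ , Sub-respˡ-≈ {t} {t'} {1} {s} e s₂

IsCas-respˡ-≈ : ∀ {t t' r bs} → t ≈ t' → IsCas t r bs → IsCas t' r bs
IsCas-respˡ-≈ {t} {t'} {r} {bs} e (h , s₀ , ss) =
  trans (sym (e [])) h , Sub-respˡ-≈ {t} {t'} {0} {r} e s₀ , SubsFrom-respˡ-≈ {t} {t'} bs e ss

≈ₙ-respˡ-≈ : ∀ {t t' f} → t ≈ t' → t ≈ₙ f → t' ≈ₙ f
≈ₙ-respˡ-≈ e h p = trans (sym (e p)) (h p)

⟶-respˡ-≈ : t ≈ t' → t ⟶ u → t' ⟶ u
⟶-respˡ-≈ {t} {t'} e (β {f} {a} {b} x y z) =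
  β {f = f} {a} {b} (IsApp-respˡ-≈ {t} {t'} {f} {a} e x) y z
⟶-respˡ-≈ {t} {t'} e (ι {s} {bs} {c} {us} {b} x y z w v) =
  ι {s = s} {bs} {c} {us} {b} (IsCas-respˡ-≈ {t} {t'} {s} {bs} e x) y z w v
⟶-respˡ-≈ {t} {t'} e (lamC {r} {r'} x y z) = lamC {r = r} {r'} (IsLam-respˡ-≈ {t} {t'} {r} e x) y z
⟶-respˡ-≈ {t} {t'} e (appL {r} {r'} {s} x y z) =
  appL {r = r} {r'} {s} (IsApp-respˡ-≈ {t} {t'} {r} {s} e x) y z
⟶-respˡ-≈ {t} {t'} e (appR {r} {s} {s'} x y z) =
  appR {r = r} {s} {s'} (IsApp-respˡ-≈ {t} {t'} {r} {s} e x) y z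
⟶-respˡ-≈ {t} {t'} e (casS {r} {r'} {bs} x y z) =
  casS {r = r} {r'} {bs} (IsCas-respˡ-≈ {t} {t'} {r} {bs} e x) y z
⟶-respˡ-≈ {t} {t'} e (casB {r} {bs} {bs'} x y z) =
  casB {r = r} {bs} {bs'} (IsCas-respˡ-≈ {t} {t'} {r} {bs} e x) y z

⟶-respʳ-≈ : u ≈ v → t ⟶ u → t ⟶ v
⟶-respʳ-≈ {u} {v} e (β {f} {a} {b} x y z) = β {f = f} {a} {b} x y (≈ₙ-respˡ-≈ {u} {v} e z)
⟶-respʳ-≈ {u} {v} e (ι {s} {bs} {c} {us} {b} x y z w w') =
  ι {s = s} {bs} {c} {us} {b} x y z w (≈ₙ-respˡ-≈ {u} {v} e w')
⟶-respʳ-≈ {u} {v} e (lamC {r} {r'} x y z) = lamC {r = r} {r'} x (IsLam-respˡ-≈ {u} {v} {r'} e y) z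
⟶-respʳ-≈ {u} {v} e (appL {r} {r'} {s} x y z) =
  appL {r = r} {r'} {s} x (IsApp-respˡ-≈ {u} {v} {r'} {s} e y) z
⟶-respʳ-≈ {u} {v} e (appR {r} {s} {s'} x y z) =
  appR {r = r} {s} {s'} x (IsApp-respˡ-≈ {u} {v} {r} {s'} e y) z
⟶-respʳ-≈ {u} {v} e (casS {r} {r'} {bs} x y z) =
  casS {r = r} {r'} {bs} x (IsCas-respˡ-≈ {u} {v} {r'} {bs} e y) z
⟶-respʳ-≈ {u} {v} e (casB {r} {bs} {bs'} x y z) =
  casB {r = r} {bs} {bs'} x (IsCas-respˡ-≈ {u} {v} {r} {bs'} e y) z

⟶*-respˡ-≈ : t ≈ t' → t ⟶* u → t' ⟶* u
⟶*-respˡ-≈ e (refl* f) = refl* λ p → trans (sym (e p)) (f p)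
⟶*-respˡ-≈ e (step* s q) = step* (⟶-respˡ-≈ e s) q

⟶*-respʳ-≈ : u ≈ v → t ⟶* u → t ⟶* v
⟶*-respʳ-≈ e (refl* f) = refl* λ p → trans (f p) (e p)
⟶*-respʳ-≈ e (step* s q) = step* s (⟶*-respʳ-≈ e q)

⟶*-refl : t ⟶* t
⟶*-refl = refl* λ _ → refl

⟶⇒⟶* : t ⟶ u → t ⟶* u
⟶⇒⟶* s = step* s ⟶*-refl

⟶*-trans : t ⟶* u → u ⟶* v → t ⟶* v
⟶*-trans (refl* f) q = ⟶*-respˡ-≈ (λ p → sym (f p)) q
⟶*-trans (step* s q) q' = step* s (⟶*-trans q q')

⟶∞-unfold : t ⟶∞ t' → Clauses _⟶*_ _⟶∞_ t t'
⟶∞-unfold (R , ρ , R-post) = map-Clauses {S = _⟶*_} (λ ρ' → R , ρ' , R-post) (R-post _ _ ρ)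

⟶∞-fold : Clauses _⟶*_ _⟶∞_ t t' → t ⟶∞ t'
⟶∞-fold = ⟶∞-coinduction (Clauses _⟶*_ _⟶∞_) λ _ _ → map-Clauses {S = _⟶*_} ⟶∞-unfold

⟶*-Clauses : {R : Term → Term → Set ℓa} → t ⟶* u → Clauses _⟶*_ R u v → Clauses _⟶*_ R t v
⟶*-Clauses q (var-clause x e s) = var-clause x e (⟶*-trans q s)
⟶*-Clauses q (con-clause k e s) = con-clause k e (⟶*-trans q s)
⟶*-Clauses q (lam-clause r' w r l' s l ρ) = lam-clause r' w r l' (⟶*-trans q s) l ρ
⟶*-Clauses q (app-clause r₁' r₂' w r₁ r₂ a' s a ρ₁ ρ₂) =
  app-clause r₁' r₂' w r₁ r₂ a' (⟶*-trans q s) a ρ₁ ρ₂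
⟶*-Clauses q (case-clause r' bs' w r bs c' s c ρ ρs) =
  case-clause r' bs' w r bs c' (⟶*-trans q s) c ρ ρs

Clauses-respʳ-≈ : {R : Term → Term → Set ℓa} → u ≈ v → Clauses _⟶*_ R t u → Clauses _⟶*_ R t v
Clauses-respʳ-≈ e (var-clause x h s) = var-clause x (trans (sym (e [])) h) (⟶*-respʳ-≈ e s)
Clauses-respʳ-≈ e (con-clause k h s) = con-clause k (trans (sym (e [])) h) (⟶*-respʳ-≈ e s)
Clauses-respʳ-≈ {u = u} {v} e (lam-clause r' w r l' s l ρ) =
  lam-clause r' w r (IsLam-respˡ-≈ {u} {v} {r'} e l') s l ρ
Clauses-respʳ-≈ {u = u} {v} e (app-clause r₁' r₂' w r₁ r₂ a' s a ρ₁ ρ₂) =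
  app-clause r₁' r₂' w r₁ r₂ (IsApp-respˡ-≈ {u} {v} {r₁'} {r₂'} e a') s a ρ₁ ρ₂
Clauses-respʳ-≈ {u = u} {v} e (case-clause r' bs' w r bs c' s c ρ ρs) =
  case-clause r' bs' w r bs (IsCas-respˡ-≈ {u} {v} {r'} {bs'} e c') s c ρ ρs

⟶*-⟶∞-trans : t ⟶* u → u ⟶∞ v → t ⟶∞ v
⟶*-⟶∞-trans q ρ = ⟶∞-fold (⟶*-Clauses q (⟶∞-unfold ρ))

⟶∞-respʳ-≈ : u ≈ v → t ⟶∞ u → t ⟶∞ v
⟶∞-respʳ-≈ e ρ = ⟶∞-fold (Clauses-respʳ-≈ e (⟶∞-unfold ρ))

⟶∞-respˡ-≈ : t ≈ t' → t' ⟶∞ u → t ⟶∞ u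
⟶∞-respˡ-≈ e = ⟶*-⟶∞-trans (refl* e)

-- De Bruijn shifting and substitution on node functions

<ᵇ-true : ∀ {j d} → j < d → (j <ᵇ d) ≡ true
<ᵇ-true h = Equivalence.to T-≡ (<⇒<ᵇ h)

<ᵇ-false : ∀ {j d} → d ≤ j → (j <ᵇ d) ≡ false
<ᵇ-false {j} {d} h with j <ᵇ d in eq
... | false = refl
... | true = ⊥-elim (<⇒≱ (<ᵇ⇒< j d (Equivalence.from T-≡ eq)) h)

data CutoffView (j d : ℕ) : Set where
  bound : j < d → CutoffView j d
  free : (x : ℕ) → j ≡ d + x → CutoffView j d

cutoff : ∀ j d → CutoffView j d
cutoff j d with j <? d
... | yes h = bound h
... | no h = free (j ∸ d) (sym (m+[n∸m]≡n (≮⇒≥ h)))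

data MaybeView (m : Maybe Label) : Set where
  absent : m ≡ nothing → MaybeView m
  present : ∀ ℓ → m ≡ just ℓ → MaybeView m

maybeView : ∀ m → MaybeView m
maybeView nothing = absent refl
maybeView (just ℓ) = present ℓ refl

data NonVar : Label → Set where
  con-nv : ∀ c → NonVar (con c)
  lam-nv : NonVar lam
  app-nv : NonVar app
  cas-nv : ∀ s → NonVar (cas s)

data RootView (f : NodeFn) : Set where
  root-absent : f [] ≡ nothing → RootView f
  root-var : ∀ j → f [] ≡ just (var j) → RootView f
  root-nonVar : ∀ ℓ → NonVar ℓ → f [] ≡ just ℓ → RootView f

rootView : ∀ f → RootView f
rootView f with f [] in eq
... | nothing = root-absent eq
... | just (var j) = root-var j eq
... | just (con c) = root-nonVar _ (con-nv c) eq
... | just lam = root-nonVar _ lam-nv eq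
... | just app = root-nonVar _ app-nv eq
... | just (cas s) = root-nonVar _ (cas-nv s) eq

substVar : ℕ → (ℕ → NodeFn) → ℕ → NodeFn
substVar d σ j p with j <ᵇ d
... | true = varNode j p
... | false = shiftNode d 0 (σ (j ∸ d)) p

substVar-bound : ∀ {d σ j} → j < d → substVar d σ j ≗ varNode j
substVar-bound {d} {σ} {j} h p rewrite <ᵇ-true h = refl

substVar-free : ∀ {d σ} x → substVar d σ (d + x) ≗ shiftNode d 0 (σ x)
substVar-free {d} {σ} x p rewrite <ᵇ-false {d + x} {d} (m≤m+n d x) | m+n∸m≡n d x = refl

substNode-absent : ∀ {d σ f} → f [] ≡ nothing → substNode d σ f ≗ (λ _ → nothing)
substNode-absent {d} {σ} {f} e p rewrite e = refl

substNode-var : ∀ {d σ f j} → f [] ≡ just (var j) → substNode d σ f ≗ substVar d σ j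
substNode-var {d} {σ} {f} {j} e p rewrite e with j <ᵇ d
... | true = refl
... | false = refl

substNode-root : ∀ {d σ f ℓ} → NonVar ℓ → f [] ≡ just ℓ → substNode d σ f [] ≡ just ℓ
substNode-root (con-nv c) e rewrite e = refl
substNode-root lam-nv e rewrite e = refl
substNode-root app-nv e rewrite e = refl
substNode-root (cas-nv s) e rewrite e = refl

substNode-child : ∀ {d σ f ℓ} → NonVar ℓ → f [] ≡ just ℓ → ∀ k p →
          substNode d σ f (k ∷ p) ≡ substNode (binders ℓ k + d) σ (λ q → f (k ∷ q)) p
substNode-child (con-nv c) e k p rewrite e = refl
substNode-child lam-nv e k p rewrite e = refl
substNode-child app-nv e k p rewrite e = refl
substNode-child (cas-nv s) e k p rewrite e = refl

shiftNode-absent : ∀ {n d g} → g [] ≡ nothing → shiftNode n d g ≗ (λ _ → nothing)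
shiftNode-absent e [] rewrite e = refl
shiftNode-absent e (k ∷ p) rewrite e = refl

shiftNode-child : ∀ {n d g ℓ} → g [] ≡ just ℓ → ∀ k p →
           shiftNode n d g (k ∷ p) ≡ shiftNode n (binders ℓ k + d) (λ q → g (k ∷ q)) p
shiftNode-child e k p rewrite e = refl

shiftLabel-nonVar : ∀ {n d ℓ} → NonVar ℓ → shiftLabel n d ℓ ≡ ℓ
shiftLabel-nonVar (con-nv c) = refl
shiftLabel-nonVar lam-nv = refl
shiftLabel-nonVar app-nv = refl
shiftLabel-nonVar (cas-nv s) = refl

shiftLabel-bound : ∀ {n d j} → j < d → shiftLabel n d (var j) ≡ var j
shiftLabel-bound h rewrite <ᵇ-true h = refl

shiftLabel-free : ∀ {n d j} → d ≤ j → shiftLabel n d (var j) ≡ var (n + j)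
shiftLabel-free {n} {d} {j} h rewrite <ᵇ-false {j} {d} h = refl

binders-shiftLabel : ∀ n d ℓ k → binders (shiftLabel n d ℓ) k ≡ binders ℓ k
binders-shiftLabel n d (var j) k with j <ᵇ d
... | true = refl
... | false = refl
binders-shiftLabel n d (con x) k = refl
binders-shiftLabel n d lam k = refl
binders-shiftLabel n d app k = refl
binders-shiftLabel n d (cas x) k = refl

arity-shiftLabel : ∀ n d ℓ → arity (shiftLabel n d ℓ) ≡ arity ℓ
arity-shiftLabel n d (var j) with j <ᵇ d
... | true = refl
... | false = refl
arity-shiftLabel n d (con x) = refl
arity-shiftLabel n d lam = refl
arity-shiftLabel n d app = refl
arity-shiftLabel n d (cas x) = refl

shiftNode-cong : ∀ {n d f g} → f ≗ g → shiftNode n d f ≗ shiftNode n d g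
shiftNode-cong e [] = cong (Maybe.map _) (e [])
shiftNode-cong {n} {d} {f} {g} e (k ∷ p) with f [] in ef
... | nothing = sym (shiftNode-absent {n} {d} {g} (trans (sym (e [])) ef) (k ∷ p))
... | just ℓ =
  trans (shiftNode-cong {n} {binders ℓ k + d} {λ q → f (k ∷ q)} {λ q → g (k ∷ q)} (λ q → e (k ∷ q)) p)
        (sym (shiftNode-child {n} {d} {g} (trans (sym (e [])) ef) k p))

substNode-cong : ∀ {d σ σ' f g} → (∀ i → σ i ≗ σ' i) → f ≗ g → substNode d σ f ≗ substNode d σ' g
substNode-cong {d} {σ} {σ'} {f} {g} es e p with rootView f
... | root-absent ef = trans (substNode-absent {d} {σ} {f} ef p) (sym (substNode-absent {d} {σ'} {g} (trans (sym (e [])) ef) p))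
... | root-var j ef = trans (substNode-var {d} {σ} {f} ef p) (trans (substVar-cong p) (sym (substNode-var {d} {σ'} {g} (trans (sym (e [])) ef) p)))
  where
  substVar-cong : substVar d σ j ≗ substVar d σ' j
  substVar-cong p with j <ᵇ d
  ... | true = refl
  ... | false = shiftNode-cong (es (j ∸ d)) p
... | root-nonVar ℓ nv ef with p
... | [] = trans (substNode-root {d} {σ} {f} nv ef) (sym (substNode-root {d} {σ'} {g} nv (trans (sym (e [])) ef)))
... | k ∷ q = trans (substNode-child {d} {σ} {f} nv ef k q)
               (trans (substNode-cong {binders ℓ k + d} {σ} {σ'} {λ r → f (k ∷ r)} {λ r → g (k ∷ r)}
                                      es (λ r → e (k ∷ r)) q)
                 (sym (substNode-child {d} {σ'} {g} nv (trans (sym (e [])) ef) k q)))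

m+e≤[e+f]+[m+x] : ∀ m e f x → m + e ≤ (e + f) + (m + x)
m+e≤[e+f]+[m+x] m e f x = subst (m + e ≤_) (reorder m e f x) (m≤m+n (m + e) (f + x))
  where
  reorder : ∀ m e f x → (m + e) + (f + x) ≡ (e + f) + (m + x)
  reorder = solve-∀

shiftLabel-shiftLabel : ∀ a e f' m ℓ → shiftLabel a (m + e) (shiftLabel (e + f') m ℓ) ≡ shiftLabel (a + (e + f')) m ℓ
shiftLabel-shiftLabel a e f' m (var j) with cutoff j m
... | bound h rewrite shiftLabel-bound {e + f'} h | shiftLabel-bound {a} {m + e} (<-≤-trans h (m≤m+n m e))
                    | shiftLabel-bound {a + (e + f')} h = refl
... | free x refl rewrite shiftLabel-free {e + f'} (m≤m+n m x) | shiftLabel-free {a + (e + f')} (m≤m+n m x)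
      | shiftLabel-free {a} {m + e} {e + f' + (m + x)} (m+e≤[e+f]+[m+x] m e f' x)
      = cong var (sym (+-assoc a (e + f') (m + x)))
shiftLabel-shiftLabel a e f' m (con x) = refl
shiftLabel-shiftLabel a e f' m lam = refl
shiftLabel-shiftLabel a e f' m app = refl
shiftLabel-shiftLabel a e f' m (cas x) = refl

shiftNode-shiftNode : ∀ a e f' m h → shiftNode a (m + e) (shiftNode (e + f') m h) ≗ shiftNode (a + (e + f')) m h
shiftNode-shiftNode a e f' m h [] with h []
... | nothing = refl
... | just ℓ = cong just (shiftLabel-shiftLabel a e f' m ℓ)
shiftNode-shiftNode a e f' m h (k ∷ p) with maybeView (h [])
... | absent eh = trans (shiftNode-absent {a} {m + e} {shiftNode (e + f') m h} (cong (Maybe.map _) eh) (k ∷ p))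
                      (sym (shiftNode-absent {a + (e + f')} {m} {h} eh (k ∷ p)))
... | present ℓ eh = begin
    shiftNode a (m + e) G (k ∷ p)
      ≡⟨ shiftNode-child {a} {m + e} {G} (cong (Maybe.map _) eh) k p ⟩
    shiftNode a (binders (shiftLabel (e + f') m ℓ) k + (m + e)) (λ q → G (k ∷ q)) p
      ≡⟨ cong (λ z → shiftNode a (z + (m + e)) (λ q → G (k ∷ q)) p) (binders-shiftLabel (e + f') m ℓ k) ⟩
    shiftNode a (b + (m + e)) (λ q → G (k ∷ q)) p
      ≡⟨ shiftNode-cong {a} {b + (m + e)} {λ q → G (k ∷ q)} {shiftNode (e + f') (b + m) h'}
                        (shiftNode-child {e + f'} {m} {h} eh k) p ⟩
    shiftNode a (b + (m + e)) (shiftNode (e + f') (b + m) h') p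
      ≡⟨ cong (λ z → shiftNode a z (shiftNode (e + f') (b + m) h') p) (sym (+-assoc b m e)) ⟩
    shiftNode a ((b + m) + e) (shiftNode (e + f') (b + m) h') p
      ≡⟨ shiftNode-shiftNode a e f' (b + m) h' p ⟩
    shiftNode (a + (e + f')) (b + m) h' p
      ≡⟨ sym (shiftNode-child {a + (e + f')} {m} {h} eh k p) ⟩
    shiftNode (a + (e + f')) m h (k ∷ p) ∎
  where
  G : NodeFn
  G = shiftNode (e + f') m h
  b : ℕ
  b = binders ℓ k
  h' : NodeFn
  h' q = h (k ∷ q)

shiftNode-root : ∀ {n d g ℓ} → g [] ≡ just ℓ → shiftNode n d g [] ≡ just (shiftLabel n d ℓ)
shiftNode-root e rewrite e = refl

shiftNode-varNode-child : ∀ n d j k p → shiftNode n d (varNode j) (k ∷ p) ≡ nothing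
shiftNode-varNode-child n d j k p = shiftNode-absent {n} {d} {λ _ → nothing} refl p

shiftNode-varNode-bound : ∀ {n d j} → j < d → shiftNode n d (varNode j) ≗ varNode j
shiftNode-varNode-bound {n} {d} {j} h [] = cong just (shiftLabel-bound h)
shiftNode-varNode-bound {n} {d} {j} h (k ∷ p) = shiftNode-varNode-child n d j k p

shiftNode-varNode-free : ∀ {n d j} → d ≤ j → shiftNode n d (varNode j) ≗ varNode (n + j)
shiftNode-varNode-free {n} {d} {j} h [] = cong just (shiftLabel-free h)
shiftNode-varNode-free {n} {d} {j} h (k ∷ p) = shiftNode-varNode-child n d j k p


substNode-varNode-bound : ∀ {d σ j} → j < d → substNode d σ (varNode j) ≗ varNode j
substNode-varNode-bound {d} {σ} j<d p = trans (substNode-var {d} {σ} {varNode _} refl p) (substVar-bound {d} {σ} j<d p)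

substNode-varNode-free : ∀ {d σ} x → substNode d σ (varNode (d + x)) ≗ shiftNode d 0 (σ x)
substNode-varNode-free {d} {σ} x p = trans (substNode-var {d} {σ} {varNode _} refl p) (substVar-free {d} {σ} x p)

substNode-var-bound : ∀ {d σ f j} → f [] ≡ just (var j) → j < d → substNode d σ f ≗ varNode j
substNode-var-bound {d} {σ} {f} e j<d p = trans (substNode-var {d} {σ} {f} e p) (substVar-bound {d} {σ} j<d p)

substNode-var-free : ∀ {d σ f} x → f [] ≡ just (var (d + x)) → substNode d σ f ≗ shiftNode d 0 (σ x)
substNode-var-free {d} {σ} {f} x e p = trans (substNode-var {d} {σ} {f} e p) (substVar-free {d} {σ} x p)

shiftNode-renaming : ∀ n (ρ : ℕ → NodeFn) → (∀ i → ρ (n + i) ≗ varNode i) →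
                     ∀ m y → shiftNode m 0 (ρ (n + y)) ≗ varNode (m + y)
shiftNode-renaming n ρ ρ-free m y p =
  trans (shiftNode-cong {m} {0} {ρ (n + y)} {varNode y} (ρ-free y) p) (shiftNode-varNode-free {m} {0} {y} z≤n p)

substNode-shiftNode-var : ∀ n c σ m g {j} → g [] ≡ just (var j) →
                          substNode (m + (n + c)) σ (shiftNode n m g) ≗ shiftNode n m (substNode (m + c) σ g)
substNode-shiftNode-var n c σ m g {j} eg p with cutoff j m
... | bound j<m = begin
  substNode (m + (n + c)) σ (shiftNode n m g) p
    ≡⟨ substNode-var-bound {m + (n + c)} {σ} {shiftNode n m g}
         (trans (shiftNode-root {n} {m} {g} eg) (cong just (shiftLabel-bound j<m))) (<-≤-trans j<m (m≤m+n m (n + c))) p ⟩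
  varNode j p
    ≡⟨ sym (shiftNode-varNode-bound {n} {m} j<m p) ⟩
  shiftNode n m (varNode j) p
    ≡⟨ sym (shiftNode-cong {n} {m} (substNode-var-bound {m + c} {σ} {g} eg (<-≤-trans j<m (m≤m+n m c))) p) ⟩
  shiftNode n m (substNode (m + c) σ g) p ∎
... | free x refl with cutoff x c
... | bound x<c = begin
  substNode (m + (n + c)) σ (shiftNode n m g) p
    ≡⟨ substNode-var-bound {m + (n + c)} {σ} {shiftNode n m g}
         (trans (shiftNode-root {n} {m} {g} eg) (cong just (shiftLabel-free (m≤m+n m x))))
         (subst (_< m + (n + c)) (sym (x∙yz≈y∙xz n m x)) (+-monoʳ-< m (+-monoʳ-< n x<c))) p ⟩
  varNode (n + (m + x)) p
    ≡⟨ sym (shiftNode-varNode-free {n} {m} (m≤m+n m x) p) ⟩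
  shiftNode n m (varNode (m + x)) p
    ≡⟨ sym (shiftNode-cong {n} {m} (substNode-var-bound {m + c} {σ} {g} eg (+-monoʳ-< m x<c)) p) ⟩
  shiftNode n m (substNode (m + c) σ g) p ∎
... | free y refl = begin
  substNode (m + (n + c)) σ (shiftNode n m g) p
    ≡⟨ substNode-var-free {m + (n + c)} {σ} {shiftNode n m g} y
         (trans (shiftNode-root {n} {m} {g} eg) (cong just (trans (shiftLabel-free (m≤m+n m (c + y))) (cong var reassoc)))) p ⟩
  shiftNode (m + (n + c)) 0 (σ y) p
    ≡⟨ cong (λ z → shiftNode z 0 (σ y) p) (sym (x∙yz≈y∙xz n m c)) ⟩
  shiftNode (n + (m + c)) 0 (σ y) p
    ≡⟨ sym (shiftNode-shiftNode n m c 0 (σ y) p) ⟩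
  shiftNode n m (shiftNode (m + c) 0 (σ y)) p
    ≡⟨ sym (shiftNode-cong {n} {m} (substNode-var-free {m + c} {σ} {g} y
                                     (trans eg (cong (λ z → just (var z)) (sym (+-assoc m c y))))) p) ⟩
  shiftNode n m (substNode (m + c) σ g) p ∎
  where
  reassoc : n + (m + (c + y)) ≡ m + (n + c) + y
  reassoc = trans (cong (n +_) (sym (+-assoc m c y))) (trans (sym (+-assoc n (m + c) y)) (cong (_+ y) (x∙yz≈y∙xz n m c)))

substNode-shiftNode : ∀ n c σ m g → substNode (m + (n + c)) σ (shiftNode n m g) ≗ shiftNode n m (substNode (m + c) σ g)
substNode-shiftNode n c σ m g p with rootView g
... | root-absent eg =
  trans (substNode-absent {m + (n + c)} {σ} {shiftNode n m g} (cong (Maybe.map _) eg) p)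
        (sym (shiftNode-absent {n} {m} {substNode (m + c) σ g} (substNode-absent {m + c} {σ} {g} eg []) p))
... | root-var j eg = substNode-shiftNode-var n c σ m g eg p
substNode-shiftNode n c σ m g [] | root-nonVar ℓ nv eg = begin
  substNode (m + (n + c)) σ (shiftNode n m g) []
    ≡⟨ substNode-root {m + (n + c)} {σ} {shiftNode n m g} nv
         (trans (shiftNode-root {n} {m} {g} eg) (cong just (shiftLabel-nonVar nv))) ⟩
  just ℓ
    ≡⟨ cong just (sym (shiftLabel-nonVar nv)) ⟩
  just (shiftLabel n m ℓ)
    ≡⟨ sym (shiftNode-root {n} {m} {substNode (m + c) σ g} (substNode-root {m + c} {σ} {g} nv eg)) ⟩
  shiftNode n m (substNode (m + c) σ g) [] ∎
substNode-shiftNode n c σ m g (k ∷ q) | root-nonVar ℓ nv eg = begin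
  substNode (m + (n + c)) σ (shiftNode n m g) (k ∷ q)
    ≡⟨ substNode-child {m + (n + c)} {σ} {shiftNode n m g} nv
         (trans (shiftNode-root {n} {m} {g} eg) (cong just (shiftLabel-nonVar nv))) k q ⟩
  substNode (b + (m + (n + c))) σ (λ r → shiftNode n m g (k ∷ r)) q
    ≡⟨ substNode-cong {b + (m + (n + c))} {σ} {σ} (λ _ _ → refl) (shiftNode-child {n} {m} {g} eg k) q ⟩
  substNode (b + (m + (n + c))) σ (shiftNode n (b + m) g') q
    ≡⟨ cong (λ z → substNode z σ (shiftNode n (b + m) g') q) (sym (+-assoc b m (n + c))) ⟩
  substNode ((b + m) + (n + c)) σ (shiftNode n (b + m) g') q
    ≡⟨ substNode-shiftNode n c σ (b + m) g' q ⟩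
  shiftNode n (b + m) (substNode ((b + m) + c) σ g') q
    ≡⟨ cong (λ z → shiftNode n (b + m) (substNode z σ g') q) (+-assoc b m c) ⟩
  shiftNode n (b + m) (substNode (b + (m + c)) σ g') q
    ≡⟨ sym (shiftNode-cong {n} {b + m} (substNode-child {m + c} {σ} {g} nv eg k) q) ⟩
  shiftNode n (b + m) (λ r → substNode (m + c) σ g (k ∷ r)) q
    ≡⟨ sym (shiftNode-child {n} {m} {substNode (m + c) σ g} (substNode-root {m + c} {σ} {g} nv eg) k q) ⟩
  shiftNode n m (substNode (m + c) σ g) (k ∷ q) ∎
  where
  b : ℕ
  b = binders ℓ k
  g' : NodeFn
  g' r = g (k ∷ r)

VarLeaves : NodeFn → Set
VarLeaves h = ∀ p j → h p ≡ just (var j) → ∀ k q → h (p ++ k ∷ q) ≡ nothing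

VarLeaves-child : ∀ {h} k → VarLeaves h → VarLeaves (λ r → h (k ∷ r))
VarLeaves-child k L p = L (k ∷ p)

VarLeaves⇒≗varNode : ∀ {h j} → VarLeaves h → h [] ≡ just (var j) → h ≗ varNode j
VarLeaves⇒≗varNode L e [] = e
VarLeaves⇒≗varNode L e (k ∷ q) = L [] _ e k q

substNode-shiftNode-cancel : ∀ n d m ρ → (∀ i → ρ (n + i) ≗ varNode i) →
                             ∀ q h → VarLeaves h → substNode (q + m) ρ (shiftNode (m + (n + d)) q h) ≗ shiftNode (m + d) q h
substNode-shiftNode-cancel n d m ρ ρ-free q h L p with rootView h
... | root-absent eh =
  trans (substNode-absent {q + m} {ρ} {shiftNode (m + (n + d)) q h} (cong (Maybe.map _) eh) p)
        (sym (shiftNode-absent {m + d} {q} {h} eh p))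
... | root-var j eh with cutoff j q
... | bound j<q = begin
  substNode (q + m) ρ (shiftNode (m + (n + d)) q h) p
    ≡⟨ substNode-var-bound {q + m} {ρ} {shiftNode (m + (n + d)) q h}
         (trans (shiftNode-root {m + (n + d)} {q} {h} eh) (cong just (shiftLabel-bound j<q))) (<-≤-trans j<q (m≤m+n q m)) p ⟩
  varNode j p
    ≡⟨ sym (shiftNode-varNode-bound {m + d} {q} j<q p) ⟩
  shiftNode (m + d) q (varNode j) p
    ≡⟨ sym (shiftNode-cong {m + d} {q} (VarLeaves⇒≗varNode L eh) p) ⟩
  shiftNode (m + d) q h p ∎
... | free x refl = begin
  substNode (q + m) ρ (shiftNode (m + (n + d)) q h) p
    ≡⟨ substNode-var-free {q + m} {ρ} {shiftNode (m + (n + d)) q h} (n + (d + x))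
         (trans (shiftNode-root {m + (n + d)} {q} {h} eh)
                (cong just (trans (shiftLabel-free (m≤m+n q x)) (cong var (reorder₁ m n d q x))))) p ⟩
  shiftNode (q + m) 0 (ρ (n + (d + x))) p
    ≡⟨ shiftNode-cong {q + m} {0} (ρ-free (d + x)) p ⟩
  shiftNode (q + m) 0 (varNode (d + x)) p
    ≡⟨ shiftNode-varNode-free {q + m} {0} z≤n p ⟩
  varNode ((q + m) + (d + x)) p
    ≡⟨ cong (λ z → varNode z p) (reorder₂ m d q x) ⟩
  varNode ((m + d) + (q + x)) p
    ≡⟨ sym (shiftNode-varNode-free {m + d} {q} (m≤m+n q x) p) ⟩
  shiftNode (m + d) q (varNode (q + x)) p
    ≡⟨ sym (shiftNode-cong {m + d} {q} (VarLeaves⇒≗varNode L eh) p) ⟩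
  shiftNode (m + d) q h p ∎
  where
  reorder₁ : ∀ m n d q x → m + (n + d) + (q + x) ≡ (q + m) + (n + (d + x))
  reorder₁ = solve-∀
  reorder₂ : ∀ m d q x → (q + m) + (d + x) ≡ (m + d) + (q + x)
  reorder₂ = solve-∀
substNode-shiftNode-cancel n d m ρ ρ-free q h L [] | root-nonVar ℓ nv eh = begin
  substNode (q + m) ρ (shiftNode (m + (n + d)) q h) []
    ≡⟨ substNode-root {q + m} {ρ} {shiftNode (m + (n + d)) q h} nv
         (trans (shiftNode-root {m + (n + d)} {q} {h} eh) (cong just (shiftLabel-nonVar nv))) ⟩
  just ℓ
    ≡⟨ cong just (sym (shiftLabel-nonVar nv)) ⟩
  just (shiftLabel (m + d) q ℓ)
    ≡⟨ sym (shiftNode-root {m + d} {q} {h} eh) ⟩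
  shiftNode (m + d) q h [] ∎
substNode-shiftNode-cancel n d m ρ ρ-free q h L (k ∷ p) | root-nonVar ℓ nv eh = begin
  substNode (q + m) ρ (shiftNode (m + (n + d)) q h) (k ∷ p)
    ≡⟨ substNode-child {q + m} {ρ} {shiftNode (m + (n + d)) q h} nv
         (trans (shiftNode-root {m + (n + d)} {q} {h} eh) (cong just (shiftLabel-nonVar nv))) k p ⟩
  substNode (b + (q + m)) ρ (λ r → shiftNode (m + (n + d)) q h (k ∷ r)) p
    ≡⟨ substNode-cong {b + (q + m)} {ρ} {ρ} (λ _ _ → refl) (shiftNode-child {m + (n + d)} {q} {h} eh k) p ⟩
  substNode (b + (q + m)) ρ (shiftNode (m + (n + d)) (b + q) h') p
    ≡⟨ cong (λ z → substNode z ρ (shiftNode (m + (n + d)) (b + q) h') p) (sym (+-assoc b q m)) ⟩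
  substNode ((b + q) + m) ρ (shiftNode (m + (n + d)) (b + q) h') p
    ≡⟨ substNode-shiftNode-cancel n d m ρ ρ-free (b + q) h' (VarLeaves-child k L) p ⟩
  shiftNode (m + d) (b + q) h' p
    ≡⟨ sym (shiftNode-child {m + d} {q} {h} eh k p) ⟩
  shiftNode (m + d) q h (k ∷ p) ∎
  where
  b : ℕ
  b = binders ℓ k
  h' : NodeFn
  h' r = h (k ∷ r)

-- The substitution lemma b[σ][ρ[σ]] = b[ρ][σ] for a ρ replacing the n variables above the
-- cutoff m: the hypotheses say that ρ' is ρ[σ] on those and that ρ, ρ' rename the variables
-- beyond them down by n.
module _ (n d : ℕ) (σ ρ ρ' : ℕ → NodeFn)
         (ρ-free : ∀ i → ρ (n + i) ≗ varNode i) (ρ'-free : ∀ i → ρ' (n + i) ≗ varNode i)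
         (ρ'-bound : ∀ i → i < n → ρ' i ≗ substNode d σ (ρ i)) (σ-leaves : ∀ i → VarLeaves (σ i)) where

  substNode-substNode-var : ∀ m b {j} → b [] ≡ just (var j) →
                            substNode m ρ' (substNode (m + (n + d)) σ b) ≗ substNode (m + d) σ (substNode m ρ b)
  substNode-substNode-var m b {j} eb p with cutoff j m
  ... | bound j<m = begin
    substNode m ρ' (substNode (m + (n + d)) σ b) p
      ≡⟨ substNode-cong {m} {ρ'} (λ _ _ → refl)
           (substNode-var-bound {m + (n + d)} {σ} {b} eb (<-≤-trans j<m (m≤m+n m (n + d)))) p ⟩
    substNode m ρ' (varNode j) p
      ≡⟨ substNode-varNode-bound {m} {ρ'} j<m p ⟩
    varNode j p
      ≡⟨ sym (substNode-varNode-bound {m + d} {σ} (<-≤-trans j<m (m≤m+n m d)) p) ⟩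
    substNode (m + d) σ (varNode j) p
      ≡⟨ sym (substNode-cong {m + d} {σ} (λ _ _ → refl) (substNode-var-bound {m} {ρ} {b} eb j<m) p) ⟩
    substNode (m + d) σ (substNode m ρ b) p ∎
  ... | free x refl with cutoff x n
  ... | bound x<n = begin
    substNode m ρ' (substNode (m + (n + d)) σ b) p
      ≡⟨ substNode-cong {m} {ρ'} (λ _ _ → refl)
           (substNode-var-bound {m + (n + d)} {σ} {b} eb (+-monoʳ-< m (<-≤-trans x<n (m≤m+n n d)))) p ⟩
    substNode m ρ' (varNode (m + x)) p
      ≡⟨ substNode-varNode-free {m} {ρ'} x p ⟩
    shiftNode m 0 (ρ' x) p
      ≡⟨ shiftNode-cong {m} {0} (ρ'-bound x x<n) p ⟩
    shiftNode m 0 (substNode d σ (ρ x)) p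
      ≡⟨ sym (substNode-shiftNode m d σ 0 (ρ x) p) ⟩
    substNode (m + d) σ (shiftNode m 0 (ρ x)) p
      ≡⟨ sym (substNode-cong {m + d} {σ} (λ _ _ → refl) (substNode-var-free {m} {ρ} {b} x eb) p) ⟩
    substNode (m + d) σ (substNode m ρ b) p ∎
  ... | free y refl with cutoff y d
  ... | bound y<d = begin
    substNode m ρ' (substNode (m + (n + d)) σ b) p
      ≡⟨ substNode-cong {m} {ρ'} (λ _ _ → refl)
           (substNode-var-bound {m + (n + d)} {σ} {b} eb (+-monoʳ-< m (+-monoʳ-< n y<d))) p ⟩
    substNode m ρ' (varNode (m + (n + y))) p
      ≡⟨ substNode-varNode-free {m} {ρ'} (n + y) p ⟩
    shiftNode m 0 (ρ' (n + y)) p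
      ≡⟨ shiftNode-renaming n ρ' ρ'-free m y p ⟩
    varNode (m + y) p
      ≡⟨ sym (substNode-varNode-bound {m + d} {σ} (+-monoʳ-< m y<d) p) ⟩
    substNode (m + d) σ (varNode (m + y)) p
      ≡⟨ sym (substNode-cong {m + d} {σ} (λ _ _ → refl)
              (λ r → trans (substNode-var-free {m} {ρ} {b} (n + y) eb r) (shiftNode-renaming n ρ ρ-free m y r)) p) ⟩
    substNode (m + d) σ (substNode m ρ b) p ∎
  ... | free z refl = begin
    substNode m ρ' (substNode (m + (n + d)) σ b) p
      ≡⟨ substNode-cong {m} {ρ'} (λ _ _ → refl)
           (substNode-var-free {m + (n + d)} {σ} {b} z (trans eb (cong (λ i → just (var i)) (reassoc m n d z)))) p ⟩
    substNode m ρ' (shiftNode (m + (n + d)) 0 (σ z)) p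
      ≡⟨ substNode-shiftNode-cancel n d m ρ' ρ'-free 0 (σ z) (σ-leaves z) p ⟩
    shiftNode (m + d) 0 (σ z) p
      ≡⟨ sym (substNode-varNode-free {m + d} {σ} z p) ⟩
    substNode (m + d) σ (varNode (m + d + z)) p
      ≡⟨ sym (substNode-cong {m + d} {σ} (λ _ _ → refl)
              (λ r → trans (substNode-var-free {m} {ρ} {b} (n + (d + z)) eb r)
                      (trans (shiftNode-renaming n ρ ρ-free m (d + z) r) (cong (λ i → varNode i r) (sym (+-assoc m d z))))) p) ⟩
    substNode (m + d) σ (substNode m ρ b) p ∎
    where
    reassoc : ∀ m n d z → m + (n + (d + z)) ≡ m + (n + d) + z
    reassoc = solve-∀

  substNode-substNode : ∀ m b → substNode m ρ' (substNode (m + (n + d)) σ b) ≗ substNode (m + d) σ (substNode m ρ b)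
  substNode-substNode m b p with rootView b
  ... | root-absent eb =
    trans (substNode-absent {m} {ρ'} {substNode (m + (n + d)) σ b} (substNode-absent {m + (n + d)} {σ} {b} eb []) p)
          (sym (substNode-absent {m + d} {σ} {substNode m ρ b} (substNode-absent {m} {ρ} {b} eb []) p))
  ... | root-var j eb = substNode-substNode-var m b eb p
  substNode-substNode m b [] | root-nonVar ℓ nv eb =
    trans (substNode-root {m} {ρ'} {substNode (m + (n + d)) σ b} nv (substNode-root {m + (n + d)} {σ} {b} nv eb))
          (sym (substNode-root {m + d} {σ} {substNode m ρ b} nv (substNode-root {m} {ρ} {b} nv eb)))
  substNode-substNode m b (k ∷ p) | root-nonVar ℓ nv eb = begin
    substNode m ρ' (substNode (m + (n + d)) σ b) (k ∷ p)
      ≡⟨ substNode-child {m} {ρ'} {substNode (m + (n + d)) σ b} nv (substNode-root {m + (n + d)} {σ} {b} nv eb) k p ⟩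
    substNode (bk + m) ρ' (λ r → substNode (m + (n + d)) σ b (k ∷ r)) p
      ≡⟨ substNode-cong {bk + m} {ρ'} (λ _ _ → refl) (substNode-child {m + (n + d)} {σ} {b} nv eb k) p ⟩
    substNode (bk + m) ρ' (substNode (bk + (m + (n + d))) σ b') p
      ≡⟨ cong (λ w → substNode (bk + m) ρ' (substNode w σ b') p) (sym (+-assoc bk m (n + d))) ⟩
    substNode (bk + m) ρ' (substNode ((bk + m) + (n + d)) σ b') p
      ≡⟨ substNode-substNode (bk + m) b' p ⟩
    substNode ((bk + m) + d) σ (substNode (bk + m) ρ b') p
      ≡⟨ cong (λ w → substNode w σ (substNode (bk + m) ρ b') p) (+-assoc bk m d) ⟩
    substNode (bk + (m + d)) σ (substNode (bk + m) ρ b') p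
      ≡⟨ sym (substNode-cong {bk + (m + d)} {σ} (λ _ _ → refl) (substNode-child {m} {ρ} {b} nv eb k) p) ⟩
    substNode (bk + (m + d)) σ (λ r → substNode m ρ b (k ∷ r)) p
      ≡⟨ sym (substNode-child {m + d} {σ} {substNode m ρ b} nv (substNode-root {m} {ρ} {b} nv eb) k p) ⟩
    substNode (m + d) σ (substNode m ρ b) (k ∷ p) ∎
    where
    bk : ℕ
    bk = binders ℓ k
    b' : NodeFn
    b' r = b (k ∷ r)

shiftNode≗substNode : ∀ n c g → VarLeaves g → shiftNode n c g ≗ substNode c (λ i → varNode (n + i)) g
shiftNode≗substNode n c g L p with rootView g
... | root-absent eg = trans (shiftNode-absent {n} {c} {g} eg p) (sym (substNode-absent {c} {λ i → varNode (n + i)} {g} eg p))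
... | root-var j eg with cutoff j c
... | bound j<c =
  trans (shiftNode-cong {n} {c} (VarLeaves⇒≗varNode L eg) p)
    (trans (shiftNode-varNode-bound {n} {c} j<c p)
      (sym (substNode-var-bound {c} {λ i → varNode (n + i)} {g} eg j<c p)))
... | free x refl =
  trans (shiftNode-cong {n} {c} (VarLeaves⇒≗varNode L eg) p)
    (trans (shiftNode-varNode-free {n} {c} (m≤m+n c x) p)
      (trans (cong (λ z → varNode z p) (x∙yz≈y∙xz n c x))
        (sym (trans (substNode-var-free {c} {λ i → varNode (n + i)} {g} x eg p) (shiftNode-varNode-free {c} {0} z≤n p)))))
shiftNode≗substNode n c g L [] | root-nonVar ℓ nv eg =
  trans (trans (shiftNode-root {n} {c} {g} eg) (cong just (shiftLabel-nonVar nv)))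
        (sym (substNode-root {c} {λ i → varNode (n + i)} {g} nv eg))
shiftNode≗substNode n c g L (k ∷ p) | root-nonVar ℓ nv eg =
  trans (shiftNode-child {n} {c} {g} eg k p)
    (trans (shiftNode≗substNode n (binders ℓ k + c) (λ r → g (k ∷ r)) (VarLeaves-child k L) p)
      (sym (substNode-child {c} {λ i → varNode (n + i)} {g} nv eg k p)))

Is-just⇒≡just : ∀ {m : Maybe Label} → Is-just m → Σ Label λ ℓ → m ≡ just ℓ
Is-just⇒≡just (just {x} _) = x , refl

≡just⇒Is-just : ∀ {m : Maybe Label} {ℓ} → m ≡ just ℓ → Is-just m
≡just⇒Is-just refl = just tt

nothing-not-Is-just : ∀ {m : Maybe Label} → m ≡ nothing → Is-just m → ⊥
nothing-not-Is-just refl ()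

Is-just-map⁻ : ∀ {h : Label → Label} {m} → Is-just (Maybe.map h m) → Is-just m
Is-just-map⁻ {m = just x} _ = just tt

Down : NodeFn → Set
Down f = ∀ p ℓ k → f p ≡ just ℓ → k < arity ℓ → Is-just (f (p ++ k ∷ []))

Up : NodeFn → Set
Up f = ∀ p k → Is-just (f (p ++ k ∷ [])) → Σ Label λ ℓ → f p ≡ just ℓ × k < arity ℓ

WellFormed : NodeFn → Set
WellFormed f = Is-just (f []) × Down f × Up f

mkTerm : (f : NodeFn) → WellFormed f → Term
mkTerm f (r , d , u) = record { node = f ; root = r ; down = d ; up = u }

wellFormed : (t : Term) → WellFormed (node t)
wellFormed t = root t , down t , up t

Down-child : ∀ {f} k → Down f → Down (λ r → f (k ∷ r))
Down-child k D p = D (k ∷ p)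

Up-child : ∀ {f} k → Up f → Up (λ r → f (k ∷ r))
Up-child k U p = U (k ∷ p)

Up⇒prefix-Is-just : ∀ {f} → Up f → ∀ p q → Is-just (f (p ++ q)) → Is-just (f p)
Up⇒prefix-Is-just {f} U p [] h = subst Is-just (cong f (++-identityʳ p)) h
Up⇒prefix-Is-just {f} U p (k ∷ q) h
  with U p k (Up⇒prefix-Is-just U (p ++ k ∷ []) q (subst Is-just (cong f (sym (++-assoc p (k ∷ []) q))) h))
... | ℓ , e , _ = ≡just⇒Is-just e

Up⇒VarLeaves : ∀ {f} → Up f → VarLeaves f
Up⇒VarLeaves {f} U p j e k q with maybeView (f (p ++ k ∷ q))
... | absent e' = e'
... | present _ e'
  with U p k (Up⇒prefix-Is-just U (p ++ k ∷ []) q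
               (subst Is-just (trans (sym e') (cong f (sym (++-assoc p (k ∷ []) q)))) (just tt)))
... | ℓ , e2 , klt with trans (sym e) e2
... | refl with klt
... | ()

shiftNode-root-Is-just : ∀ {n d g} → Is-just (g []) → Is-just (shiftNode n d g [])
shiftNode-root-Is-just {n} {d} {g} h with Is-just⇒≡just h
... | ℓ , e = ≡just⇒Is-just (shiftNode-root {n} {d} {g} e)

shiftNode-Down : ∀ n d g → Down g → Down (shiftNode n d g)
shiftNode-Down n d g D [] ℓ k e kl with maybeView (g [])
... | absent eg = ⊥-elim (nothing-not-Is-just (shiftNode-absent {n} {d} {g} eg []) (≡just⇒Is-just e))
... | present ℓ0 eg with trans (sym (shiftNode-root {n} {d} {g} eg)) e
... | refl = subst Is-just (sym (shiftNode-child {n} {d} {g} eg k []))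
               (shiftNode-root-Is-just {n} {binders ℓ0 k + d} {λ r → g (k ∷ r)}
                  (D [] ℓ0 k eg (subst (k <_) (arity-shiftLabel n d ℓ0) kl)))
shiftNode-Down n d g D (k' ∷ p) ℓ k e kl with maybeView (g [])
... | absent eg = ⊥-elim (nothing-not-Is-just (shiftNode-absent {n} {d} {g} eg (k' ∷ p)) (≡just⇒Is-just e))
... | present ℓ0 eg = subst Is-just (sym (shiftNode-child {n} {d} {g} eg k' (p ++ k ∷ [])))
      (shiftNode-Down n (binders ℓ0 k' + d) (λ r → g (k' ∷ r)) (Down-child k' D) p ℓ k
         (trans (sym (shiftNode-child {n} {d} {g} eg k' p)) e) kl)

shiftNode-Up : ∀ n d g → Up g → Up (shiftNode n d g)
shiftNode-Up n d g U [] k h with maybeView (g [])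
... | absent eg = ⊥-elim (nothing-not-Is-just (shiftNode-absent {n} {d} {g} eg (k ∷ [])) h)
... | present ℓ0 eg with U [] k (Is-just-map⁻ (subst Is-just (shiftNode-child {n} {d} {g} eg k []) h))
... | ℓ , e , kl with trans (sym eg) e
... | refl = shiftLabel n d ℓ0 , shiftNode-root {n} {d} {g} eg , subst (k <_) (sym (arity-shiftLabel n d ℓ0)) kl
shiftNode-Up n d g U (k' ∷ p) k h with maybeView (g [])
... | absent eg = ⊥-elim (nothing-not-Is-just (shiftNode-absent {n} {d} {g} eg (k' ∷ (p ++ k ∷ []))) h)
... | present ℓ0 eg with shiftNode-Up n (binders ℓ0 k' + d) (λ r → g (k' ∷ r)) (Up-child k' U) p k
                         (subst Is-just (shiftNode-child {n} {d} {g} eg k' (p ++ k ∷ [])) h)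
... | ℓ , e , kl = ℓ , trans (shiftNode-child {n} {d} {g} eg k' p) e , kl

shiftNode-WellFormed : ∀ n d g → WellFormed g → WellFormed (shiftNode n d g)
shiftNode-WellFormed n d g (r , D , U) = shiftNode-root-Is-just {n} {d} {g} r , shiftNode-Down n d g D , shiftNode-Up n d g U

varNode-WellFormed : ∀ j → WellFormed (varNode j)
varNode-WellFormed j = just tt , D , U
  where
  D : Down (varNode j)
  D [] ℓ k refl ()
  D (_ ∷ _) ℓ k () kl
  U : Up (varNode j)
  U [] k ()
  U (_ ∷ _) k ()

substVar-WellFormed : ∀ d σ → (∀ i → WellFormed (σ i)) → ∀ j → WellFormed (substVar d σ j)
substVar-WellFormed d σ vσ j with j <ᵇ d
... | true = varNode-WellFormed j
... | false = shiftNode-WellFormed d 0 (σ (j ∸ d)) (vσ (j ∸ d))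

substNode-root-Is-just : ∀ d σ → (∀ i → WellFormed (σ i)) → ∀ g → Is-just (g []) → Is-just (substNode d σ g [])
substNode-root-Is-just d σ vσ g h with rootView g
... | root-absent eg = ⊥-elim (nothing-not-Is-just eg h)
... | root-var j eg = subst Is-just (sym (substNode-var {d} {σ} {g} eg [])) (proj₁ (substVar-WellFormed d σ vσ j))
... | root-nonVar ℓ nv eg = ≡just⇒Is-just (substNode-root {d} {σ} {g} nv eg)

substNode-root-Is-just⁻ : ∀ d σ g → Is-just (substNode d σ g []) → Is-just (g [])
substNode-root-Is-just⁻ d σ g h with rootView g
... | root-absent eg = ⊥-elim (nothing-not-Is-just (substNode-absent {d} {σ} {g} eg []) h)
... | root-var j eg = ≡just⇒Is-just eg
... | root-nonVar ℓ nv eg = ≡just⇒Is-just eg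

substNode-Down : ∀ d σ → (∀ i → WellFormed (σ i)) → ∀ g → Down g → Down (substNode d σ g)
substNode-Down d σ vσ g D p ℓ k e kl with rootView g
... | root-absent eg = ⊥-elim (nothing-not-Is-just (substNode-absent {d} {σ} {g} eg p) (≡just⇒Is-just e))
... | root-var j eg = subst Is-just (sym (substNode-var {d} {σ} {g} eg (p ++ k ∷ [])))
                    (proj₁ (proj₂ (substVar-WellFormed d σ vσ j)) p ℓ k (trans (sym (substNode-var {d} {σ} {g} eg p)) e) kl)
substNode-Down d σ vσ g D [] ℓ k e kl | root-nonVar ℓ0 nv eg with trans (sym (substNode-root {d} {σ} {g} nv eg)) e
... | refl = subst Is-just (sym (substNode-child {d} {σ} {g} nv eg k []))
               (substNode-root-Is-just (binders ℓ0 k + d) σ vσ (λ r → g (k ∷ r)) (D [] ℓ0 k eg kl))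
substNode-Down d σ vσ g D (k' ∷ p) ℓ k e kl | root-nonVar ℓ0 nv eg =
  subst Is-just (sym (substNode-child {d} {σ} {g} nv eg k' (p ++ k ∷ [])))
    (substNode-Down (binders ℓ0 k' + d) σ vσ (λ r → g (k' ∷ r)) (Down-child k' D) p ℓ k
       (trans (sym (substNode-child {d} {σ} {g} nv eg k' p)) e) kl)

substNode-Up : ∀ d σ → (∀ i → WellFormed (σ i)) → ∀ g → Up g → Up (substNode d σ g)
substNode-Up d σ vσ g U p k h with rootView g
... | root-absent eg = ⊥-elim (nothing-not-Is-just (substNode-absent {d} {σ} {g} eg (p ++ k ∷ [])) h)
... | root-var j eg
  with proj₂ (proj₂ (substVar-WellFormed d σ vσ j)) p k (subst Is-just (substNode-var {d} {σ} {g} eg (p ++ k ∷ [])) h)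
... | ℓ , e , kl = ℓ , trans (substNode-var {d} {σ} {g} eg p) e , kl
substNode-Up d σ vσ g U [] k h | root-nonVar ℓ0 nv eg
  with U [] k (substNode-root-Is-just⁻ (binders ℓ0 k + d) σ (λ r → g (k ∷ r))
                 (subst Is-just (substNode-child {d} {σ} {g} nv eg k []) h))
... | ℓ , e , kl with trans (sym eg) e
... | refl = ℓ0 , substNode-root {d} {σ} {g} nv eg , kl
substNode-Up d σ vσ g U (k' ∷ p) k h | root-nonVar ℓ0 nv eg
  with substNode-Up (binders ℓ0 k' + d) σ vσ (λ r → g (k' ∷ r)) (Up-child k' U) p k
                         (subst Is-just (substNode-child {d} {σ} {g} nv eg k' (p ++ k ∷ [])) h)
... | ℓ , e , kl = ℓ , trans (substNode-child {d} {σ} {g} nv eg k' p) e , kl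

substNode-WellFormed : ∀ d σ → (∀ i → WellFormed (σ i)) → ∀ g → WellFormed g → WellFormed (substNode d σ g)
substNode-WellFormed d σ vσ g (r , D , U) = substNode-root-Is-just d σ vσ g r , substNode-Down d σ vσ g D , substNode-Up d σ vσ g U


record Env : Set where
  field
    fn : ℕ → NodeFn
    fn-wf : ∀ i → WellFormed (fn i)
open Env

substTerm : ℕ → Env → Term → Term
substTerm d σ s = mkTerm (substNode d (fn σ) (node s)) (substNode-WellFormed d (fn σ) (fn-wf σ) (node s) (wellFormed s))

substNodeᵀ : ℕ → Env → Term → NodeFn
substNodeᵀ d σ s = substNode d (fn σ) (node s)

substBranch : ℕ → Env → Branch → Branch
substBranch d σ (c , n , b) = (c , n , substTerm (n + d) σ b)

substBranches : ℕ → Env → List Branch → List Branch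
substBranches d σ = map (substBranch d σ)

sigOf-substBranches : ∀ d σ bs → sigOf (substBranches d σ bs) ≡ sigOf bs
sigOf-substBranches d σ bs = sym (map-∘ bs)

map-proj₁-substBranches : ∀ d σ bs → map proj₁ (substBranches d σ bs) ≡ map proj₁ bs
map-proj₁-substBranches d σ bs = sym (map-∘ bs)

nthArity-drop : ∀ (sig : List (ℕ × ℕ)) j {c n rest} → drop j sig ≡ (c , n) ∷ rest → nthArity sig j ≡ n
nthArity-drop [] zero ()
nthArity-drop [] (suc j) ()
nthArity-drop (x ∷ sig) zero refl = refl
nthArity-drop (x ∷ sig) (suc j) e = nthArity-drop sig j e

drop-suc : ∀ {A : Set} (sig : List A) j {x rest} → drop j sig ≡ x ∷ rest → drop (suc j) sig ≡ rest
drop-suc [] zero ()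
drop-suc [] (suc j) ()
drop-suc (y ∷ sig) zero refl = refl
drop-suc (y ∷ sig) (suc j) e = drop-suc sig j e

substNode-root-≈ₙ : ∀ d σ {s ℓ} (a : Term) → NonVar ℓ → node s [] ≡ just ℓ →
                    a ≈ₙ substNodeᵀ d σ s → node a [] ≡ just ℓ
substNode-root-≈ₙ d σ {s} a nv e h = trans (h []) (substNode-root {d} {fn σ} {node s} nv e)

Sub-substNode : ∀ d σ {s ℓ k r} (a X : Term) → NonVar ℓ → node s [] ≡ just ℓ → Sub s k r →
         a ≈ₙ substNodeᵀ d σ s → X ≈ₙ substNodeᵀ (binders ℓ k + d) σ r → Sub a k X
Sub-substNode d σ {s} {ℓ} {k} {r} a X nv e sb h hX p = begin
  node X p ≡⟨ hX p ⟩
  substNode (binders ℓ k + d) (fn σ) (node r) p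
    ≡⟨ substNode-cong {binders ℓ k + d} {fn σ} {fn σ} {node r} {λ q → node s (k ∷ q)} (λ i q → refl) sb p ⟩
  substNode (binders ℓ k + d) (fn σ) (λ q → node s (k ∷ q)) p
    ≡⟨ sym (substNode-child {d} {fn σ} {node s} nv e k p) ⟩
  substNodeᵀ d σ s (k ∷ p) ≡⟨ sym (h (k ∷ p)) ⟩
  node a (k ∷ p) ∎

IsLam-substNode : ∀ d σ {s r} (a : Term) → IsLam s r → a ≈ₙ substNodeᵀ d σ s → IsLam a (substTerm (suc d) σ r)
IsLam-substNode d σ {s} {r} a (e , sb) h =
  substNode-root-≈ₙ d σ {s} a lam-nv e h ,
  Sub-substNode d σ {s} {lam} {0} {r} a (substTerm (suc d) σ r) lam-nv e sb h (λ p → refl)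

IsApp-substNode : ∀ d σ {s r₁ r₂} (a : Term) → IsApp s r₁ r₂ → a ≈ₙ substNodeᵀ d σ s →
                  IsApp a (substTerm d σ r₁) (substTerm d σ r₂)
IsApp-substNode d σ {s} {r₁} {r₂} a (e , sb1 , sb2) h =
  substNode-root-≈ₙ d σ {s} a app-nv e h ,
  Sub-substNode d σ {s} {app} {0} {r₁} a (substTerm d σ r₁) app-nv e sb1 h (λ p → refl) ,
  Sub-substNode d σ {s} {app} {1} {r₂} a (substTerm d σ r₂) app-nv e sb2 h (λ p → refl)

SubsFrom-substNode : ∀ d σ {s} (a : Term) sig → node s [] ≡ just (cas sig) → a ≈ₙ substNodeᵀ d σ s →
          ∀ j bs → drop j sig ≡ sigOf bs → SubsFrom s (suc j) bs → SubsFrom a (suc j) (substBranches d σ bs)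
SubsFrom-substNode d σ {s} a sig e h j [] eq sb = tt
SubsFrom-substNode d σ {s} a sig e h j ((c , n , b) ∷ bs) eq (sb , sbs) =
  Sub-substNode d σ {s} {cas sig} {suc j} {b} a (substTerm (n + d) σ b) (cas-nv sig) e sb h
     (λ p → cong (λ z → substNode (z + d) (fn σ) (node b) p) (sym (nthArity-drop sig j eq))) ,
  SubsFrom-substNode d σ {s} a sig e h (suc j) bs (drop-suc sig j eq) sbs

IsCas-substNode : ∀ d σ {s r bs} (a : Term) → IsCas s r bs → a ≈ₙ substNodeᵀ d σ s →
                  IsCas a (substTerm d σ r) (substBranches d σ bs)
IsCas-substNode d σ {s} {r} {bs} a (e , sb , sbs) h =
  trans (substNode-root-≈ₙ d σ {s} a (cas-nv (sigOf bs)) e h) (cong (λ z → just (cas z)) (sym (sigOf-substBranches d σ bs))) ,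
  Sub-substNode d σ {s} {cas (sigOf bs)} {0} {r} a (substTerm d σ r) (cas-nv (sigOf bs)) e sb h (λ p → refl) ,
  SubsFrom-substNode d σ {s} a (sigOf bs) e h 0 bs refl sbs

IsLam-substTerm : ∀ d σ {s r} → IsLam s r → IsLam (substTerm d σ s) (substTerm (suc d) σ r)
IsLam-substTerm d σ {s} {r} l = IsLam-substNode d σ {s} {r} (substTerm d σ s) l λ _ → refl

IsApp-substTerm : ∀ d σ {s r₁ r₂} → IsApp s r₁ r₂ → IsApp (substTerm d σ s) (substTerm d σ r₁) (substTerm d σ r₂)
IsApp-substTerm d σ {s} {r₁} {r₂} a = IsApp-substNode d σ {s} {r₁} {r₂} (substTerm d σ s) a λ _ → refl

IsCas-substTerm : ∀ d σ {s r bs} → IsCas s r bs → IsCas (substTerm d σ s) (substTerm d σ r) (substBranches d σ bs)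
IsCas-substTerm d σ {s} {r} {bs} c = IsCas-substNode d σ {s} {r} {bs} (substTerm d σ s) c λ _ → refl

Spine-substTerm : ∀ d σ {s c us} → Spine s c us → Spine (substTerm d σ s) c (map (substTerm d σ) us)
Spine-substTerm d σ {s} (sc {c = c} e) = sc (substNode-root {d} {fn σ} {node s} (con-nv c) e)
Spine-substTerm d σ {s} (sa {f = f} {u} {c} {us} a sp) =
  subst (Spine (substTerm d σ s) c) (sym (map-++ (substTerm d σ) us (u ∷ [])))
    (sa (IsApp-substTerm d σ {s} {f} {u} a) (Spine-substTerm d σ sp))

Env-VarLeaves : ∀ σ i → VarLeaves (fn σ i)
Env-VarLeaves σ i = Up⇒VarLeaves (proj₂ (proj₂ (fn-wf σ i)))

sub0-WellFormed : ∀ a i → WellFormed (sub0 a i)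
sub0-WellFormed a zero = wellFormed a
sub0-WellFormed a (suc i) = varNode-WellFormed i

sub0Env : Term → Env
sub0Env a = record { fn = sub0 a ; fn-wf = sub0-WellFormed a }

listSub-WellFormed : ∀ us i → WellFormed (listSub us i)
listSub-WellFormed [] i = varNode-WellFormed i
listSub-WellFormed (u ∷ us) zero = wellFormed u
listSub-WellFormed (u ∷ us) (suc i) = listSub-WellFormed us i

listSubEnv : List Term → Env
listSubEnv us = record { fn = listSub us ; fn-wf = listSub-WellFormed us }

listSub-free : ∀ us i → listSub us (length us + i) ≗ varNode i
listSub-free [] i p = refl
listSub-free (u ∷ us) i = listSub-free us i

listSub-map-free : ∀ (F : Term → Term) us i → listSub (map F us) (length us + i) ≗ varNode i
listSub-map-free F [] i p = refl
listSub-map-free F (u ∷ us) i = listSub-map-free F us i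

listSub-map-bound : ∀ d σ us i → i < length us → listSub (map (substTerm d σ) us) i ≗ substNode d (fn σ) (listSub us i)
listSub-map-bound d σ [] i ()
listSub-map-bound d σ (u ∷ us) zero h p = refl
listSub-map-bound d σ (u ∷ us) (suc i) (s≤s h) = listSub-map-bound d σ us i h

mutual
  ⟶-substTerm : ∀ d σ {s s'} → s ⟶ s' → substTerm d σ s ⟶ substTerm d σ s'
  ⟶-substTerm d σ {s} {s'} (β {f} {a} {b} isApp isLam s'≈) =
    β {f = substTerm d σ f} {substTerm d σ a} {substTerm (suc d) σ b}
      (IsApp-substTerm d σ {s} {f} {a} isApp) (IsLam-substTerm d σ {f} {b} isLam) λ p →
      trans (substNode-cong {d} {fn σ} {fn σ} {node s'} {substNode 0 (sub0 a) (node b)} (λ _ _ → refl) s'≈ p)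
            (sym (substNode-substNode 1 d (fn σ) (sub0 a) (sub0 (substTerm d σ a)) (λ _ _ → refl) (λ _ _ → refl)
                    sub0-bound (Env-VarLeaves σ) 0 (node b) p))
    where
    sub0-bound : ∀ i → i < 1 → sub0 (substTerm d σ a) i ≗ substNode d (fn σ) (sub0 a i)
    sub0-bound zero _ _ = refl
    sub0-bound (suc _) (s≤s ())
  ⟶-substTerm d σ {s} {s'} (ι {s₀} {bs} {c} {us} {b} isCas unique sp b∈bs s'≈) =
    ι {s = substTerm d σ s₀} {substBranches d σ bs} {c} {map (substTerm d σ) us} {substTerm (length us + d) σ b}
      (IsCas-substTerm d σ {s} {s₀} {bs} isCas)
      (subst Unique (sym (map-proj₁-substBranches d σ bs)) unique)
      (Spine-substTerm d σ sp)
      (subst (λ n → (c , n , substTerm (length us + d) σ b) ∈ substBranches d σ bs) (sym (length-map (substTerm d σ) us))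
             (∈-map⁺ (substBranch d σ) b∈bs)) λ p →
      trans (substNode-cong {d} {fn σ} {fn σ} {node s'} {substNode 0 (listSub us) (node b)} (λ _ _ → refl) s'≈ p)
            (sym (substNode-substNode (length us) d (fn σ) (listSub us) (listSub (map (substTerm d σ) us))
                    (listSub-free us) (listSub-map-free (substTerm d σ) us) (listSub-map-bound d σ us) (Env-VarLeaves σ) 0 (node b) p))
  ⟶-substTerm d σ {s} {s'} (lamC {r} {r'} l l' st) =
    lamC {r = substTerm (suc d) σ r} {substTerm (suc d) σ r'}
      (IsLam-substTerm d σ {s} {r} l) (IsLam-substTerm d σ {s'} {r'} l') (⟶-substTerm (suc d) σ st)
  ⟶-substTerm d σ {s} {s'} (appL {r} {r'} {q} a a' st) =
    appL {r = substTerm d σ r} {substTerm d σ r'} {substTerm d σ q}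
      (IsApp-substTerm d σ {s} {r} {q} a) (IsApp-substTerm d σ {s'} {r'} {q} a') (⟶-substTerm d σ st)
  ⟶-substTerm d σ {s} {s'} (appR {r} {q} {q'} a a' st) =
    appR {r = substTerm d σ r} {substTerm d σ q} {substTerm d σ q'}
      (IsApp-substTerm d σ {s} {r} {q} a) (IsApp-substTerm d σ {s'} {r} {q'} a') (⟶-substTerm d σ st)
  ⟶-substTerm d σ {s} {s'} (casS {r} {r'} {bs} c c' st) =
    casS {r = substTerm d σ r} {substTerm d σ r'} {substBranches d σ bs}
      (IsCas-substTerm d σ {s} {r} {bs} c) (IsCas-substTerm d σ {s'} {r'} {bs} c') (⟶-substTerm d σ st)
  ⟶-substTerm d σ {s} {s'} (casB {r} {bs} {bs'} c c' st) =
    casB {r = substTerm d σ r} {substBranches d σ bs} {substBranches d σ bs'}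
      (IsCas-substTerm d σ {s} {r} {bs} c) (IsCas-substTerm d σ {s'} {r} {bs'} c') (OneBranch-substBranches d σ st)

  OneBranch-substBranches : ∀ d σ {bs bs'} → OneBranch _⟶_ bs bs' →
                            OneBranch _⟶_ (substBranches d σ bs) (substBranches d σ bs')
  OneBranch-substBranches d σ (here {n = n} st) = here (⟶-substTerm (n + d) σ st)
  OneBranch-substBranches d σ (there st) = there (OneBranch-substBranches d σ st)

⟶*-substTerm : ∀ d σ {s s'} → s ⟶* s' → substTerm d σ s ⟶* substTerm d σ s'
⟶*-substTerm d σ {s} {s'} (refl* e) = refl* (substNode-cong {d} {fn σ} {fn σ} {node s} {node s'} (λ i q → refl) e)
⟶*-substTerm d σ (step* st r) = step* (⟶-substTerm d σ st) (⟶*-substTerm d σ r)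

childTerm : (t : Term) {ℓ : Label} (k : ℕ) → node t [] ≡ just ℓ → k < arity ℓ → Term
childTerm t {ℓ} k e k<arity =
  mkTerm (λ q → node t (k ∷ q)) (down t [] ℓ k e k<arity , Down-child k (down t) , Up-child k (up t))

module CaseBranches (t : Term) (sig : List (ℕ × ℕ)) (e : node t [] ≡ just (cas sig)) where

  branchesFrom : ∀ j (rest : List (ℕ × ℕ)) → j + length rest ≡ length sig → List Branch
  branchesFrom j [] _ = []
  branchesFrom j ((c , n) ∷ rest) eq =
    (c , n , childTerm t (suc j) e (s≤s (subst (j <_) eq (m<m+n j z<s)))) ∷
    branchesFrom (suc j) rest (trans (sym (+-suc j (length rest))) eq)

  sigOf-branchesFrom : ∀ j rest eq → sigOf (branchesFrom j rest eq) ≡ rest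
  sigOf-branchesFrom j [] _ = refl
  sigOf-branchesFrom j ((c , n) ∷ rest) _ = cong ((c , n) ∷_) (sigOf-branchesFrom (suc j) rest _)

  SubsFrom-branchesFrom : ∀ j rest eq → SubsFrom t (suc j) (branchesFrom j rest eq)
  SubsFrom-branchesFrom j [] _ = tt
  SubsFrom-branchesFrom j ((c , n) ∷ rest) _ = (λ _ → refl) , SubsFrom-branchesFrom (suc j) rest _

  branches : List Branch
  branches = branchesFrom 0 sig refl

  IsCas-branches : IsCas t (childTerm t 0 e z<s) branches
  IsCas-branches = trans e (cong (λ sig' → just (cas sig')) (sym (sigOf-branchesFrom 0 sig refl))) ,
                   (λ _ → refl) , SubsFrom-branchesFrom 0 sig refl

≈-BrRel-refl : ∀ bs → Pointwise (BrRel _≈_) bs bs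
≈-BrRel-refl [] = []
≈-BrRel-refl (_ ∷ bs) = (refl , refl , λ _ → refl) ∷ ≈-BrRel-refl bs

≈-post : PostFixedPoint _⟶*_ _≈_
≈-post t u e with rootView (node u)
... | root-absent eu = ⊥-elim (nothing-not-Is-just eu (root u))
... | root-var x eu = var-clause x eu (refl* e)
... | root-nonVar (con k) _ eu = con-clause k eu (refl* e)
... | root-nonVar lam _ eu = lam-clause r u r isLam (refl* e) isLam λ _ → refl
  where
  r : Term
  r = childTerm u 0 eu z<s
  isLam : IsLam u r
  isLam = eu , λ _ → refl
... | root-nonVar app _ eu = app-clause r₁ r₂ u r₁ r₂ isApp (refl* e) isApp (λ _ → refl) (λ _ → refl)
  where
  r₁ r₂ : Term
  r₁ = childTerm u 0 eu z<s
  r₂ = childTerm u 1 eu (s<s z<s)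
  isApp : IsApp u r₁ r₂
  isApp = eu , (λ _ → refl) , (λ _ → refl)
... | root-nonVar (cas sig) _ eu =
  case-clause r branches u r branches IsCas-branches (refl* e) IsCas-branches (λ _ → refl) (≈-BrRel-refl branches)
  where
  open CaseBranches u sig eu
  r : Term
  r = childTerm u 0 eu z<s

≈⇒⟶∞ : t ≈ u → t ⟶∞ u
≈⇒⟶∞ = ⟶∞-coinduction _≈_ ≈-post

⟶∞-refl : ∀ t → t ⟶∞ t
⟶∞-refl t = ≈⇒⟶∞ {t} {t} λ _ → refl

-- Infinitary reduction is closed under substitution

no-child-beyond-arity : ∀ (s : Term) {ℓ} k p → node s [] ≡ just ℓ → ¬ (k < arity ℓ) → node s (k ∷ p) ≡ nothing
no-child-beyond-arity s k p e k≮arity with maybeView (node s (k ∷ p))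
... | absent e' = e'
... | present _ e' with up s [] k (Up⇒prefix-Is-just (up s) (k ∷ []) p (≡just⇒Is-just e'))
... | _ , e'' , k<arity with trans (sym e) e''
... | refl = ⊥-elim (k≮arity k<arity)

substNode-con-irrelevant : ∀ d σ σ' (s : Term) {c} → node s [] ≡ just (con c) →
                           substNodeᵀ d σ s ≗ substNodeᵀ d σ' s
substNode-con-irrelevant d σ σ' s e [] =
  trans (substNode-root {d} {fn σ} {node s} (con-nv _) e) (sym (substNode-root {d} {fn σ'} {node s} (con-nv _) e))
substNode-con-irrelevant d σ σ' s {c} e (k ∷ p) = begin
  substNodeᵀ d σ s (k ∷ p)         ≡⟨ substNode-child {d} {fn σ} {node s} (con-nv _) e k p ⟩
  substNode d (fn σ) s-k p          ≡⟨ substNode-absent {d} {fn σ} {s-k} no-child p ⟩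
  nothing                           ≡⟨ sym (substNode-absent {d} {fn σ'} {s-k} no-child p) ⟩
  substNode d (fn σ') s-k p         ≡⟨ sym (substNode-child {d} {fn σ'} {node s} (con-nv _) e k p) ⟩
  substNodeᵀ d σ' s (k ∷ p)        ∎
  where
  s-k : NodeFn
  s-k q = node s (k ∷ q)
  no-child : s-k [] ≡ nothing
  no-child = no-child-beyond-arity s k [] e λ ()

⟶*-substTerm-≈ₙ : ∀ d σ {a s u} → a ≈ₙ substNodeᵀ d σ s → s ⟶* u → a ⟶* substTerm d σ u
⟶*-substTerm-≈ₙ d σ {a} {s} ea q = ⟶*-respˡ-≈ {substTerm d σ s} {a} (λ p → sym (ea p)) (⟶*-substTerm d σ q)

ShiftsReduce : Env → Env → Set₁
ShiftsReduce σ σ' = ∀ d y (a b : Term) → a ≈ₙ shiftNode d 0 (fn σ y) → b ≈ₙ shiftNode d 0 (fn σ' y) → a ⟶∞ b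

-- Coinduction on pairs (σ s , σ' s') with s ⟶∞ s'; once a free variable y is met, the
-- reduction is no longer of that form and is supplied by the hypothesis on σ y and σ' y.
module _ (σ σ' : Env) (shifts-reduce : ShiftsReduce σ σ') where

  private
    SubstPair : Term → Term → Set₁
    SubstPair a b = Σ Term λ s → Σ Term λ s' → Σ ℕ λ d →
                    (a ≈ₙ substNodeᵀ d σ s) × (b ≈ₙ substNodeᵀ d σ' s') × (s ⟶∞ s')

    W : Term → Term → Set₁
    W a b = SubstPair a b ⊎ (a ⟶∞ b)

    pair : ∀ d {s s'} → s ⟶∞ s' → W (substTerm d σ s) (substTerm d σ' s')
    pair d {s} {s'} ρ = inj₁ (s , s' , d , (λ _ → refl) , (λ _ → refl) , ρ)

    pair-branches : ∀ d {bs bs'} → Pointwise (BrRel _⟶∞_) bs bs' →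
                    Pointwise (BrRel W) (substBranches d σ bs) (substBranches d σ' bs')
    pair-branches d [] = []
    pair-branches d {(_ , n , _) ∷ _} {(_ , _ , _) ∷ _} ((refl , refl , ρ) ∷ ρs) =
      (refl , refl , pair (n + d) ρ) ∷ pair-branches d ρs

    SubstPair-post : ∀ {a b} d {s s'} → a ≈ₙ substNodeᵀ d σ s → b ≈ₙ substNodeᵀ d σ' s' →
                     Clauses _⟶*_ _⟶∞_ s s' → Clauses _⟶*_ W a b
    SubstPair-post d {s' = s'} ea eb (var-clause x es' q) with cutoff x d
    ... | bound x<d =
      var-clause x (trans (eb []) (substNode-var-bound {d} {fn σ'} {node s'} es' x<d []))
        (⟶*-respʳ-≈ (λ p → trans (substNode-var-bound {d} {fn σ} {node s'} es' x<d p)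
                                  (sym (trans (eb p) (substNode-var-bound {d} {fn σ'} {node s'} es' x<d p))))
                     (⟶*-substTerm-≈ₙ d σ ea q))
    ... | free y refl =
      map-Clauses {S = _⟶*_} inj₂ (⟶*-Clauses (⟶*-substTerm-≈ₙ d σ ea q) (⟶∞-unfold
        (shifts-reduce d y (substTerm d σ s') _ (substNode-var-free {d} {fn σ} {node s'} y es')
                       (λ p → trans (eb p) (substNode-var-free {d} {fn σ'} {node s'} y es' p)))))
    SubstPair-post d {s' = s'} ea eb (con-clause k es' q) =
      con-clause k (trans (eb []) (substNode-root {d} {fn σ'} {node s'} (con-nv k) es'))
        (⟶*-respʳ-≈ (λ p → trans (substNode-con-irrelevant d σ σ' s' es' p) (sym (eb p)))
                     (⟶*-substTerm-≈ₙ d σ ea q))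
    SubstPair-post {b = b} d {s' = s'} ea eb (lam-clause r' u r l' q l ρ) =
      lam-clause _ _ _ (IsLam-substNode d σ' {s'} {r'} b l' eb) (⟶*-substTerm-≈ₙ d σ ea q)
        (IsLam-substTerm d σ {u} {r} l) (pair (suc d) ρ)
    SubstPair-post {b = b} d {s' = s'} ea eb (app-clause r₁' r₂' u r₁ r₂ a' q a ρ₁ ρ₂) =
      app-clause _ _ _ _ _ (IsApp-substNode d σ' {s'} {r₁'} {r₂'} b a' eb) (⟶*-substTerm-≈ₙ d σ ea q)
        (IsApp-substTerm d σ {u} {r₁} {r₂} a) (pair d ρ₁) (pair d ρ₂)
    SubstPair-post {b = b} d {s' = s'} ea eb (case-clause r' bs' u r bs c' q c ρ ρs) =
      case-clause _ _ _ _ _ (IsCas-substNode d σ' {s'} {r'} {bs'} b c' eb) (⟶*-substTerm-≈ₙ d σ ea q)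
        (IsCas-substTerm d σ {u} {r} {bs} c) (pair d ρ) (pair-branches d ρs)

    W-post : PostFixedPoint _⟶*_ W
    W-post a b (inj₁ (s , s' , d , ea , eb , ρ)) = SubstPair-post d ea eb (⟶∞-unfold ρ)
    W-post a b (inj₂ ρ) = map-Clauses {S = _⟶*_} inj₂ (⟶∞-unfold ρ)

  ShiftsReduce⇒⟶∞-substTerm : ∀ d {s s'} → s ⟶∞ s' → substTerm d σ s ⟶∞ substTerm d σ' s'
  ShiftsReduce⇒⟶∞-substTerm d ρ = ⟶∞-coinduction W W-post (pair d ρ)

shiftEnv : ℕ → Env
shiftEnv n = record { fn = λ i → varNode (n + i) ; fn-wf = λ i → varNode-WellFormed (n + i) }

shiftEnv-ShiftsReduce : ∀ n → ShiftsReduce (shiftEnv n) (shiftEnv n)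
shiftEnv-ShiftsReduce n d y a b ea eb = ≈⇒⟶∞ {a} {b} λ p → trans (ea p) (sym (eb p))

⟶∞-shiftNode : ∀ d {g g'} (a b : Term) → g ⟶∞ g' →
               a ≈ₙ shiftNode d 0 (node g) → b ≈ₙ shiftNode d 0 (node g') → a ⟶∞ b
⟶∞-shiftNode d {g} {g'} a b ρ ea eb =
  ⟶∞-respˡ-≈ {a} {substTerm 0 (shiftEnv d) g}
    (λ p → trans (ea p) (shiftNode≗substNode d 0 (node g) (Up⇒VarLeaves (up g)) p))
    (⟶∞-respʳ-≈ (λ p → sym (trans (eb p) (shiftNode≗substNode d 0 (node g') (Up⇒VarLeaves (up g')) p)))
      (ShiftsReduce⇒⟶∞-substTerm (shiftEnv d) (shiftEnv d) (shiftEnv-ShiftsReduce d) 0 ρ))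

envTerm : Env → ℕ → Term
envTerm σ i = mkTerm (fn σ i) (fn-wf σ i)

_⟶∞ᴱ_ : Env → Env → Set₁
σ ⟶∞ᴱ σ' = ∀ i → envTerm σ i ⟶∞ envTerm σ' i

⟶∞-substTerm : ∀ {σ σ'} → σ ⟶∞ᴱ σ' → ∀ d {s s'} → s ⟶∞ s' → substTerm d σ s ⟶∞ substTerm d σ' s'
⟶∞-substTerm {σ} {σ'} σ⟶∞σ' = ShiftsReduce⇒⟶∞-substTerm σ σ' λ d y a b → ⟶∞-shiftNode d a b (σ⟶∞σ' y)

root-clash : ∀ {A : Set ℓa} {ℓ ℓ'} (u : Term) → ℓ ≢ ℓ' → node u [] ≡ just ℓ → node u [] ≡ just ℓ' → A
root-clash u ℓ≢ℓ' e e' = ⊥-elim (ℓ≢ℓ' (just-injective (trans (sym e) e')))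

⟶∞-var⁻ : ∀ {x} → t ⟶∞ u → node u [] ≡ just (var x) → t ⟶* u
⟶∞-var⁻ {u = u} ρ e with ⟶∞-unfold ρ
... | var-clause _ _ q = q
... | con-clause _ _ q = q
... | lam-clause _ _ _ (e' , _) _ _ _ = root-clash u (λ ()) e e'
... | app-clause _ _ _ _ _ (e' , _) _ _ _ _ = root-clash u (λ ()) e e'
... | case-clause _ _ _ _ _ (e' , _) _ _ _ _ = root-clash u (λ ()) e e'

⟶∞-con⁻ : ∀ {k} → t ⟶∞ u → node u [] ≡ just (con k) → t ⟶* u
⟶∞-con⁻ {u = u} ρ e with ⟶∞-unfold ρ
... | var-clause _ _ q = q
... | con-clause _ _ q = q
... | lam-clause _ _ _ (e' , _) _ _ _ = root-clash u (λ ()) e e'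
... | app-clause _ _ _ _ _ (e' , _) _ _ _ _ = root-clash u (λ ()) e e'
... | case-clause _ _ _ _ _ (e' , _) _ _ _ _ = root-clash u (λ ()) e e'

⟶∞-lam⁻ : ∀ {r} → t ⟶∞ u → IsLam u r →
          Σ Term λ w → Σ Term λ r₀ → (t ⟶* w) × IsLam w r₀ × (r₀ ⟶∞ r)
⟶∞-lam⁻ {u = u} {r} ρ (e , s) with ⟶∞-unfold ρ
... | var-clause _ e' _ = root-clash u (λ ()) e e'
... | con-clause _ e' _ = root-clash u (λ ()) e e'
... | lam-clause r' w r₀ (_ , s') q l ρ₀ = w , r₀ , q , l , ⟶∞-respʳ-≈ (Sub-unique {u} {0} {r'} {r} s' s) ρ₀
... | app-clause _ _ _ _ _ (e' , _) _ _ _ _ = root-clash u (λ ()) e e'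
... | case-clause _ _ _ _ _ (e' , _) _ _ _ _ = root-clash u (λ ()) e e'

⟶∞-app⁻ : ∀ {r₁ r₂} → t ⟶∞ u → IsApp u r₁ r₂ →
          Σ Term λ w → Σ Term λ r₁₀ → Σ Term λ r₂₀ →
          (t ⟶* w) × IsApp w r₁₀ r₂₀ × (r₁₀ ⟶∞ r₁) × (r₂₀ ⟶∞ r₂)
⟶∞-app⁻ {u = u} {r₁} {r₂} ρ (e , s₁ , s₂) with ⟶∞-unfold ρ
... | var-clause _ e' _ = root-clash u (λ ()) e e'
... | con-clause _ e' _ = root-clash u (λ ()) e e'
... | lam-clause _ _ _ (e' , _) _ _ _ = root-clash u (λ ()) e e'
... | app-clause r₁' r₂' w r₁₀ r₂₀ (_ , s₁' , s₂') q a ρ₁ ρ₂ =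
  w , r₁₀ , r₂₀ , q , a , ⟶∞-respʳ-≈ (Sub-unique {u} {0} {r₁'} {r₁} s₁' s₁) ρ₁
                        , ⟶∞-respʳ-≈ (Sub-unique {u} {1} {r₂'} {r₂} s₂' s₂) ρ₂
... | case-clause _ _ _ _ _ (e' , _) _ _ _ _ = root-clash u (λ ()) e e'

BrRel-⟶∞-SubsFrom : ∀ (u : Term) j {bs₀ bs₁ bs} → Pointwise (BrRel _⟶∞_) bs₀ bs₁ →
                     SubsFrom u j bs₁ → SubsFrom u j bs → sigOf bs₁ ≡ sigOf bs →
                     Pointwise (BrRel _⟶∞_) bs₀ bs
BrRel-⟶∞-SubsFrom u j {bs = []} [] _ _ _ = []
BrRel-⟶∞-SubsFrom u j {bs₁ = (_ , _ , b₁) ∷ _} {(_ , _ , b) ∷ _} ((c≡ , n≡ , ρ) ∷ ρs) (s₁ , ss₁) (s , ss) sig≡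
  with ∷-injective sig≡
... | refl , sig≡' = (c≡ , n≡ , ⟶∞-respʳ-≈ (Sub-unique {u} {j} {b₁} {b} s₁ s) ρ) ∷
                     BrRel-⟶∞-SubsFrom u (suc j) ρs ss₁ ss sig≡'

⟶∞-cas⁻ : ∀ {r bs} → t ⟶∞ u → IsCas u r bs →
          Σ Term λ w → Σ Term λ r₀ → Σ (List Branch) λ bs₀ →
          (t ⟶* w) × IsCas w r₀ bs₀ × (r₀ ⟶∞ r) × Pointwise (BrRel _⟶∞_) bs₀ bs
⟶∞-cas⁻ {u = u} {r} ρ (e , s , ss) with ⟶∞-unfold ρ
... | var-clause _ e' _ = root-clash u (λ ()) e e'
... | con-clause _ e' _ = root-clash u (λ ()) e e'
... | lam-clause _ _ _ (e' , _) _ _ _ = root-clash u (λ ()) e e'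
... | app-clause _ _ _ _ _ (e' , _) _ _ _ _ = root-clash u (λ ()) e e'
... | case-clause r' _ w r₀ bs₀ (e' , s' , ss') q c ρ₀ ρs =
  w , r₀ , bs₀ , q , c , ⟶∞-respʳ-≈ (Sub-unique {u} {0} {r'} {r} s' s) ρ₀ ,
  BrRel-⟶∞-SubsFrom u 1 ρs ss' ss (cas-injective (trans (sym e') e))
  where
  cas-injective : ∀ {sig sig'} → just (cas sig) ≡ just (cas sig') → sig ≡ sig'
  cas-injective refl = refl

replaceChildNode : Term → ℕ → Term → NodeFn
replaceChildNode z k y [] = node z []
replaceChildNode z k y (j ∷ p) with j ≟ k
... | yes _ = node y p
... | no _ = node z (j ∷ p)

replaceChild : (z : Term) (k : ℕ) (y : Term) {ℓ : Label} → node z [] ≡ just ℓ → k < arity ℓ → Term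
replaceChild z k y {ℓ} ez k<arity = mkTerm (replaceChildNode z k y) (root z , D , U)
  where
  D : Down (replaceChildNode z k y)
  D [] ℓ' k' e k'<arity with k' ≟ k
  ... | yes _ = root y
  ... | no _ = down z [] ℓ' k' e k'<arity
  D (j ∷ p) ℓ' k' e k'<arity with j ≟ k
  ... | yes _ = down y p ℓ' k' e k'<arity
  ... | no _ = down z (j ∷ p) ℓ' k' e k'<arity
  U : Up (replaceChildNode z k y)
  U [] k' h with k' ≟ k
  ... | yes refl = ℓ , ez , k<arity
  ... | no _ = up z [] k' h
  U (j ∷ p) k' h with j ≟ k
  ... | yes _ = up y p k' h
  ... | no _ = up z (j ∷ p) k' h

SubsFrom-replaceChild : ∀ (z : Term) {ℓ} (ez : node z [] ≡ just ℓ) (0<arity : 0 < arity ℓ) y j bs →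
                        SubsFrom z (suc j) bs → SubsFrom (replaceChild z 0 y ez 0<arity) (suc j) bs
SubsFrom-replaceChild z ez 0<arity y j [] _ = tt
SubsFrom-replaceChild z ez 0<arity y j (_ ∷ bs) (s , ss) = s , SubsFrom-replaceChild z ez 0<arity y (suc j) bs ss

⟶*-appˡ : ∀ {r r' z s} → r ⟶* r' → IsApp z r s → Σ Term λ z' → (z ⟶* z') × IsApp z' r' s
⟶*-appˡ {r} {r'} {z} {s} (refl* e) (ez , s₁ , s₂) = z , ⟶*-refl , ez , Sub-respʳ-≈ {z} {0} {r} {r'} e s₁ , s₂
⟶*-appˡ {r} {r'} {z} {s} (step* {u = r₁} st q) isApp@(ez , _ , s₂) =
  let z' , q' , isApp' = ⟶*-appˡ {r₁} {r'} {z₁} {s} q isApp₁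
  in z' , step* (appL {r = r} {r₁} {s} isApp isApp₁ st) q' , isApp'
  where
  z₁ : Term
  z₁ = replaceChild z 0 r₁ ez z<s
  isApp₁ : IsApp z₁ r₁ s
  isApp₁ = ez , (λ _ → refl) , s₂

⟶*-casˡ : ∀ {r r' z bs} → r ⟶* r' → IsCas z r bs → Σ Term λ z' → (z ⟶* z') × IsCas z' r' bs
⟶*-casˡ {r} {r'} {z} {bs} (refl* e) (ez , s₀ , ss) = z , ⟶*-refl , ez , Sub-respʳ-≈ {z} {0} {r} {r'} e s₀ , ss
⟶*-casˡ {r} {r'} {z} {bs} (step* {u = r₁} st q) isCas@(ez , _ , ss) =
  let z' , q' , isCas' = ⟶*-casˡ {r₁} {r'} {z₁} {bs} q isCas₁
  in z' , step* (casS {r = r} {r₁} {bs} isCas isCas₁ st) q' , isCas'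
  where
  z₁ : Term
  z₁ = replaceChild z 0 r₁ ez z<s
  isCas₁ : IsCas z₁ r₁ bs
  isCas₁ = ez , (λ _ → refl) , SubsFrom-replaceChild z ez z<s r₁ 0 bs ss

-- Appending a finite reduction to an infinitary one

⟶∞-Spine⁻ : ∀ {k us} → t ⟶∞ u → Spine u k us →
            Σ Term λ w → Σ (List Term) λ us₀ → (t ⟶* w) × Spine w k us₀ × Pointwise _⟶∞_ us₀ us
⟶∞-Spine⁻ {u = u} ρ (sc e) = u , [] , ⟶∞-con⁻ ρ e , sc e , []
⟶∞-Spine⁻ ρ (sa {f = f} {a} isApp sp) with ⟶∞-app⁻ {r₁ = f} {a} ρ isApp
... | w , f₀ , a₀ , q , isApp₀ , ρf , ρa with ⟶∞-Spine⁻ ρf sp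
... | w₁ , us₀ , q₁ , sp₀ , ρs with ⟶*-appˡ {f₀} {w₁} {w} {a₀} q₁ isApp₀
... | w' , q' , isApp' = w' , us₀ ∷ʳ a₀ , ⟶*-trans q q' , sa isApp' sp₀ , ++⁺ ρs (ρa ∷ [])

∈-BrRel⁻ : ∀ {bs₀ bs c n b} → Pointwise (BrRel _⟶∞_) bs₀ bs → (c , n , b) ∈ bs →
           Σ Term λ b₀ → ((c , n , b₀) ∈ bs₀) × (b₀ ⟶∞ b)
∈-BrRel⁻ {(_ , _ , b₀) ∷ _} ((refl , refl , ρ) ∷ _) (here refl) = b₀ , here refl , ρ
∈-BrRel⁻ (_ ∷ ρs) (there m) with ∈-BrRel⁻ ρs m
... | b₀ , m₀ , ρ = b₀ , there m₀ , ρ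

map-proj₁-BrRel : ∀ {bs₀ bs} → Pointwise (BrRel _⟶∞_) bs₀ bs → map proj₁ bs₀ ≡ map proj₁ bs
map-proj₁-BrRel ρs = Pointwise.Pointwise-≡⇒≡ (Pointwise.map⁺ proj₁ proj₁ (Pointwise.map proj₁ ρs))

sub0Env-⟶∞ᴱ : ∀ {a₀ a} → a₀ ⟶∞ a → sub0Env a₀ ⟶∞ᴱ sub0Env a
sub0Env-⟶∞ᴱ ρ zero = ρ
sub0Env-⟶∞ᴱ ρ (suc i) = ⟶∞-refl _

listSubEnv-⟶∞ᴱ : ∀ {us₀ us} → Pointwise _⟶∞_ us₀ us → listSubEnv us₀ ⟶∞ᴱ listSubEnv us
listSubEnv-⟶∞ᴱ [] i = ⟶∞-refl _
listSubEnv-⟶∞ᴱ (ρ ∷ _) zero = ρ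
listSubEnv-⟶∞ᴱ (_ ∷ ρs) (suc i) = listSubEnv-⟶∞ᴱ ρs i

-- A redex of u is traced back through t ⟶∞ u to a redex reachable from t by ⟶*; contracting it
-- there and applying the substitution lemma to the reducts of its parts gives the reduct of u.
mutual
  ⟶∞-⟶-trans : t ⟶∞ u → u ⟶ v → t ⟶∞ v
  ⟶∞-⟶-trans {v = v} ρ (β {f} {a} {b} isApp isLam v≈) with ⟶∞-app⁻ {r₁ = f} {a} ρ isApp
  ... | w , f₀ , a₀ , q , isApp₀ , ρf , ρa with ⟶∞-lam⁻ {r = b} ρf isLam
  ... | w₁ , b₀ , q₁ , isLam₀ , ρb with ⟶*-appˡ {f₀} {w₁} {w} {a₀} q₁ isApp₀
  ... | w' , q' , isApp' =
    ⟶*-⟶∞-trans (⟶*-trans q (⟶*-trans q' (⟶⇒⟶* (β {f = w₁} {a₀} {b₀} isApp' isLam₀ λ _ → refl))))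
      (⟶∞-respʳ-≈ (λ p → sym (v≈ p)) (⟶∞-substTerm (sub0Env-⟶∞ᴱ ρa) 0 ρb))
  ⟶∞-⟶-trans {v = v} ρ (ι {s} {bs} {k} {us} {b} isCas unique sp b∈bs v≈) with ⟶∞-cas⁻ {r = s} {bs} ρ isCas
  ... | w , s₀ , bs₀ , q , isCas₀ , ρs , ρbs with ⟶∞-Spine⁻ ρs sp
  ... | w₁ , us₀ , q₁ , sp₀ , ρus with ⟶*-casˡ {s₀} {w₁} {w} {bs₀} q₁ isCas₀
  ... | w' , q' , isCas' with ∈-BrRel⁻ ρbs b∈bs
  ... | b₀ , b₀∈bs₀ , ρb =
    ⟶*-⟶∞-trans (⟶*-trans q (⟶*-trans q' (⟶⇒⟶* (ι {s = w₁} {bs₀} {k} {us₀} {b₀} isCas'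
        (subst Unique (sym (map-proj₁-BrRel ρbs)) unique) sp₀
        (subst (λ n → (k , n , b₀) ∈ bs₀) (sym (Pointwise-length ρus)) b₀∈bs₀) λ _ → refl))))
      (⟶∞-respʳ-≈ (λ p → sym (v≈ p)) (⟶∞-substTerm (listSubEnv-⟶∞ᴱ ρus) 0 ρb))
  ⟶∞-⟶-trans ρ (lamC {r} {r'} isLam isLam' st) with ⟶∞-lam⁻ {r = r} ρ isLam
  ... | w , r₀ , q , isLam₀ , ρr = ⟶∞-fold (lam-clause r' w r₀ isLam' q isLam₀ (⟶∞-⟶-trans ρr st))
  ⟶∞-⟶-trans ρ (appL {r} {r'} {s} isApp isApp' st) with ⟶∞-app⁻ {r₁ = r} {s} ρ isApp
  ... | w , r₀ , s₀ , q , isApp₀ , ρr , ρs =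
    ⟶∞-fold (app-clause r' s w r₀ s₀ isApp' q isApp₀ (⟶∞-⟶-trans ρr st) ρs)
  ⟶∞-⟶-trans ρ (appR {r} {s} {s'} isApp isApp' st) with ⟶∞-app⁻ {r₁ = r} {s} ρ isApp
  ... | w , r₀ , s₀ , q , isApp₀ , ρr , ρs =
    ⟶∞-fold (app-clause r s' w r₀ s₀ isApp' q isApp₀ ρr (⟶∞-⟶-trans ρs st))
  ⟶∞-⟶-trans ρ (casS {r} {r'} {bs} isCas isCas' st) with ⟶∞-cas⁻ {r = r} {bs} ρ isCas
  ... | w , r₀ , bs₀ , q , isCas₀ , ρr , ρbs =
    ⟶∞-fold (case-clause r' bs w r₀ bs₀ isCas' q isCas₀ (⟶∞-⟶-trans ρr st) ρbs)
  ⟶∞-⟶-trans ρ (casB {r} {bs} {bs'} isCas isCas' st) with ⟶∞-cas⁻ {r = r} {bs} ρ isCas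
  ... | w , r₀ , bs₀ , q , isCas₀ , ρr , ρbs =
    ⟶∞-fold (case-clause r bs' w r₀ bs₀ isCas' q isCas₀ ρr (⟶∞-OneBranch-trans ρbs st))

  ⟶∞-OneBranch-trans : ∀ {bs₀ bs bs'} → Pointwise (BrRel _⟶∞_) bs₀ bs → OneBranch _⟶_ bs bs' →
                       Pointwise (BrRel _⟶∞_) bs₀ bs'
  ⟶∞-OneBranch-trans ((c≡ , n≡ , ρ) ∷ ρs) (here st) = (c≡ , n≡ , ⟶∞-⟶-trans ρ st) ∷ ρs
  ⟶∞-OneBranch-trans (ρ ∷ ρs) (there st) = ρ ∷ ⟶∞-OneBranch-trans ρs st

⟶∞-⟶*-trans : t ⟶∞ u → u ⟶* v → t ⟶∞ v
⟶∞-⟶*-trans ρ (refl* e) = ⟶∞-respʳ-≈ e ρ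
⟶∞-⟶*-trans ρ (step* st q) = ⟶∞-⟶*-trans (⟶∞-⟶-trans ρ st) q

module _ {S : Term → Term → Set ℓa} {R : Term → Term → Set ℓb} (R-post : PostFixedPoint S R)
         (⟶∞-S-trans : ∀ {t u v} → t ⟶∞ u → S u v → t ⟶∞ v) where

  private
    _⟶∞∘R_ : Term → Term → Set (Level.suc Level.zero Level.⊔ ℓb)
    t ⟶∞∘R v = Σ Term λ u → (t ⟶∞ u) × R u v

    BrRel-∘ : ∀ {x y z} → BrRel _⟶∞_ x y → BrRel R y z → BrRel _⟶∞∘R_ x z
    BrRel-∘ {y = _ , _ , b} (c≡ , n≡ , ρ) (c≡' , n≡' , r) = trans c≡ c≡' , trans n≡ n≡' , (b , ρ , r)

    ⟶∞∘R-post : PostFixedPoint _⟶*_ _⟶∞∘R_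
    ⟶∞∘R-post t v (u , ρ , r) with R-post u v r
    ... | var-clause x e s = var-clause x e (⟶∞-var⁻ (⟶∞-S-trans ρ s) e)
    ... | con-clause k e s = con-clause k e (⟶∞-con⁻ (⟶∞-S-trans ρ s) e)
    ... | lam-clause r' w r₁ l' s l r₁r' =
      let w₀ , r₀ , q , l₀ , ρ₁ = ⟶∞-lam⁻ {r = r₁} (⟶∞-S-trans ρ s) l
      in lam-clause r' w₀ r₀ l' q l₀ (r₁ , ρ₁ , r₁r')
    ... | app-clause r₁' r₂' w r₁ r₂ a' s a r₁r₁' r₂r₂' =
      let w₀ , r₁₀ , r₂₀ , q , a₀ , ρ₁ , ρ₂ = ⟶∞-app⁻ {r₁ = r₁} {r₂} (⟶∞-S-trans ρ s) a
      in app-clause r₁' r₂' w₀ r₁₀ r₂₀ a' q a₀ (r₁ , ρ₁ , r₁r₁') (r₂ , ρ₂ , r₂r₂')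
    ... | case-clause r' bs' w r₁ bs c' s c r₁r' rbs =
      let w₀ , r₀ , bs₀ , q , c₀ , ρ₁ , ρbs = ⟶∞-cas⁻ {r = r₁} {bs} (⟶∞-S-trans ρ s) c
      in case-clause r' bs' w₀ r₀ bs₀ c' q c₀ (r₁ , ρ₁ , r₁r') (Pointwise.transitive BrRel-∘ ρbs rbs)

  ⟶∞-postFixedPoint-trans : t ⟶∞ u → R u v → t ⟶∞ v
  ⟶∞-postFixedPoint-trans ρ r = ⟶∞-coinduction _⟶∞∘R_ ⟶∞∘R-post (_ , ρ , r)

⟶∞-trans : t ⟶∞ u → u ⟶∞ v → t ⟶∞ v
⟶∞-trans ρ = ⟶∞-postFixedPoint-trans {R = _⟶∞_} (λ _ _ → ⟶∞-unfold) ⟶∞-⟶*-trans ρ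

lemma2p5 : (t t' : Term) → t ⟶2∞ t' → t ⟶∞ t'
lemma2p5 t t' (R , r , R-post) = ⟶∞-postFixedPoint-trans R-post ⟶∞-trans (⟶∞-refl t) r
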